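{- Let $q$ be an odd prime power, let $E\subset\mathbb{F}_q^2$ be nonempty, and $n:=|E|$. For $t\in\mathbb{F}_q$ let $\nu(t):=|\{(\mathbf{x},\mathbf{y})\in E^2:\|\mathbf{x}-\mathbf{y}\|_P=t\}|$. Then \[ \sum_{t\in\mathbb{F}_q}\nu(t)^2\le\frac{n^4}{q}+q\,\mathcal{E}_{\mathrm{fib}}(E), \] and consequently \[ |\Delta_P(E)|\ge\frac{n^4}{\frac{n^4}{q}+q\,\mathcal{E}_{\mathrm{fib}}(E)}=\frac{q}{1+\frac{q^2\mathcal{E}_{\mathrm{fib}}(E)}{n^4}}. \]
   Context: For $\mathbf{x}=(x_1,x_2),\mathbf{y}=(y_1,y_2)\in\mathbb{F}_q^2$, the parabolic distance is $\|\mathbf{x}-\mathbf{y}\|_P:=(x_2-y_2)+(x_1-y_1)^2$, and $\Delta_P(E):=\{\|\mathbf{x}-\mathbf{y}\|_P:\mathbf{x},\mathbf{y}\in E\}$. For finite $P,Q\subset\mathbb{F}_q$, the additive energy is $E_+(P,Q):=|\{(x,x',y,y')\in P^2\times Q^2: x+y=x'+y'\}|$. For $u\in\mathbb{F}_q$, the vertical fiber is $E_u:=\{y\in\mathbb{F}_q:(u,y)\in E\}$, and the fiber alignment energy is $\mathcal{E}_{\mathrm{fib}}(E):=\sum_{u,u'\in\mathbb{F}_q}E_+(E_u,E_{u'})$. -}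

module Defs where

open import Level using (0ℓ)
open import Data.Bool using (Bool; true; false; _∧_; if_then_else_)
open import Data.Nat using (ℕ; zero; suc)
import Data.Nat as ℕ
open import Data.Product using (_×_; _,_; ∃)
open import Data.List using (List; []; _∷_; length; map; concatMap)
open import Data.Nat.ListAction using (sum)
open import Data.Bool.ListAction using (any)
open import Data.List.Membership.Propositional using (_∈_)
open import Data.List.Relation.Unary.Unique.Propositional using (Unique)
open import Relation.Binary.PropositionalEquality using (_≡_; _≢_)
open import Relation.Binary.Definitions using (DecidableEquality)
open import Relation.Nullary.Decidable using (⌊_⌋)
open import Algebra.Structures using (IsCommutativeRing)

record FiniteField : Set₁ where
  infixl 6 _+_ _-_
  infixl 7 _*_
  field
    Carrier  : Set
    _+_ _*_  : Carrier → Carrier → Carrier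
    -_       : Carrier → Carrier
    0# 1#    : Carrier
    isCommutativeRing : IsCommutativeRing _≡_ _+_ _*_ -_ 0# 1#
    0≢1      : 0# ≢ 1#
    inverse  : ∀ x → x ≢ 0# → ∃ λ y → x * y ≡ 1#
    _≟_      : DecidableEquality Carrier
    elements : List Carrier
    unique   : Unique elements
    complete : ∀ x → x ∈ elements

  _-_ : Carrier → Carrier → Carrier
  x - y = x + (- y)

  order : ℕ
  order = length elements

count : {A : Set} → (A → Bool) → List A → ℕ
count p []       = 0
count p (x ∷ xs) = if p x then suc (count p xs) else count p xs

_⊗_ : {A B : Set} → List A → List B → List (A × B)
xs ⊗ ys = concatMap (λ x → map (λ y → (x , y)) ys) xs

module _ (F : FiniteField) where
  open FiniteField F

  Pt : Set
  Pt = Carrier × Carrier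

  points : List Pt
  points = elements ⊗ elements

  parDist : Pt → Pt → Carrier
  parDist (x₁ , x₂) (y₁ , y₂) = (x₂ - y₂) + (x₁ - y₁) * (x₁ - y₁)

  card : (Pt → Bool) → ℕ
  card E = count E points

  distIs : (Pt → Bool) → Carrier → Pt × Pt → Bool
  distIs E t (x , y) = E x ∧ E y ∧ ⌊ parDist x y ≟ t ⌋

  ν : (Pt → Bool) → Carrier → ℕ
  ν E t = count (distIs E t) (points ⊗ points)

  sumν² : (Pt → Bool) → ℕ
  sumν² E = sum (map (λ t → ν E t ℕ.* ν E t) elements)

  distanceSetSize : (Pt → Bool) → ℕ
  distanceSetSize E = count (λ t → any (distIs E t) (points ⊗ points)) elements

  additiveEnergy : (Carrier → Bool) → (Carrier → Bool) → ℕ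
  additiveEnergy P Q =
    count (λ { ((x , x′) , (y , y′)) →
               P x ∧ P x′ ∧ Q y ∧ Q y′ ∧ ⌊ (x + y) ≟ (x′ + y′) ⌋ })
          ((elements ⊗ elements) ⊗ (elements ⊗ elements))

  fiber : (Pt → Bool) → Carrier → Carrier → Bool
  fiber E u y = E (u , y)

  fiberEnergy : (Pt → Bool) → ℕ
  fiberEnergy E =
    sum (map (λ { (u , u′) → additiveEnergy (fiber E u) (fiber E u′) })
             (elements ⊗ elements))

module Submission where

-- Let f be the indicator of E, n = |E|, and G w d the number of points of E on the parabola
-- {(v , d + (w - v)²)}, so that ν t = Σ_{u,x} f(u,x) G(u, x - t). By the additive-energy
-- identity, 𝓔_fib(E) = Σ_z H(z)² with H(z) = Σ_u Σ_c f(u,c) f(u,c+z).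
-- Expanding squares and using only 2ab ≤ a² + b² (no Fourier analysis), for any weights
--   Σ_t (Σ_u Σ_x a(u,x) b(u,x - t))² ≤ Σ_z (Σ_u Σ_c a(u,c) a(u,c+z)) (Σ_w Σ_d b(w,d) b(w,d+z)).
-- With a = f and the centered b = q G - n the left side is q² Σ_t ν(t)² - q n⁴. On the right,
-- the parabola conditions for two fibres v ≠ v′ differ by an affine function of w of slope
-- 2 (v - v′), which is invertible in odd characteristic; so distinct fibres contribute only
-- |E_v| |E_v′|, and the right side is q³ Σ_z H(z)² - q² (Σ_u |E_u|²)² ≤ q³ 𝓔_fib(E).
-- The bound on |Δ_P(E)| is Cauchy–Schwarz: n⁴ = (Σ_t ν(t))² ≤ |Δ_P(E)| Σ_t ν(t)².

open import Algebra.Bundles using (CommutativeRing)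
open import Data.Bool using (Bool)
open import Data.Integer using (ℤ)
open import Defs

module IntegerSums where

  open import Data.Bool using (Bool; true; false; _∧_)
  open import Data.Bool.ListAction using (any)
  open import Data.Integer using (ℤ; +_; -[1+_]; 0ℤ; 1ℤ; _+_; _*_; _-_; -_; _^_; _≤_; +≤+)
  import Data.Integer.Properties as ℤ
  open import Data.Integer.Tactic.RingSolver using (solve-∀)
  open import Data.List using (List; []; _∷_; _++_; map; length)
  open import Data.Nat as ℕ using (ℕ; zero; suc; z≤n)
  import Data.Nat.ListAction as ℕ
  open import Data.Product using (_×_; _,_)
  open import Relation.Binary.PropositionalEquality using (_≡_; refl; sym; trans; cong; cong₂; subst; subst₂; module ≡-Reasoning)

  ⟦_⟧ : Bool → ℤ
  ⟦ true ⟧  = 1ℤ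
  ⟦ false ⟧ = 0ℤ

  ⟦∧⟧ : ∀ a b → ⟦ a ∧ b ⟧ ≡ ⟦ a ⟧ * ⟦ b ⟧
  ⟦∧⟧ true  b = sym (ℤ.*-identityˡ ⟦ b ⟧)
  ⟦∧⟧ false b = refl

  ⟦b⟧*⟦b⟧ : ∀ b → ⟦ b ⟧ * ⟦ b ⟧ ≡ ⟦ b ⟧
  ⟦b⟧*⟦b⟧ true  = refl
  ⟦b⟧*⟦b⟧ false = refl

  ⟦any⟧*count : ∀ {A : Set} (p : A → Bool) xs → ⟦ any p xs ⟧ * + count p xs ≡ + count p xs
  ⟦any⟧*count p []       = refl
  ⟦any⟧*count p (x ∷ xs) with p x
  ... | true  = ℤ.*-identityˡ _
  ... | false = ⟦any⟧*count p xs

  pos-^ : ∀ m n → + (m ℕ.^ n) ≡ (+ m) ^ n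
  pos-^ m zero    = refl
  pos-^ m (suc n) = trans (ℤ.pos-* m (m ℕ.^ n)) (cong (+ m *_) (pos-^ m n))

  0≤i*i : ∀ i → 0ℤ ≤ i * i
  0≤i*i (+ n)    = subst (0ℤ ≤_) (ℤ.pos-* n n) (+≤+ z≤n)
  0≤i*i -[1+ n ] = +≤+ z≤n

  2ij≤i*i+j*j : ∀ i j → + 2 * (i * j) ≤ i * i + j * j
  2ij≤i*i+j*j i j = subst₂ _≤_ (ℤ.+-identityˡ _) (square-expand i j) (ℤ.+-monoˡ-≤ (+ 2 * (i * j)) (0≤i*i (i - j)))
    where
    square-expand : ∀ i j → (i - j) * (i - j) + + 2 * (i * j) ≡ i * i + j * j
    square-expand = solve-∀

  module _ {A : Set} where

    ∑ : List A → (A → ℤ) → ℤ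
    ∑ []       f = 0ℤ
    ∑ (x ∷ xs) f = f x + ∑ xs f

    syntax ∑ xs (λ x → e) = ∑[ x ∈ xs ] e

    ∑-cong : ∀ xs {f g : A → ℤ} → (∀ x → f x ≡ g x) → ∑ xs f ≡ ∑ xs g
    ∑-cong []       f≗g = refl
    ∑-cong (x ∷ xs) f≗g = cong₂ _+_ (f≗g x) (∑-cong xs f≗g)

    ∑-mono-≤ : ∀ xs {f g : A → ℤ} → (∀ x → f x ≤ g x) → ∑ xs f ≤ ∑ xs g
    ∑-mono-≤ []       f≤g = ℤ.≤-refl
    ∑-mono-≤ (x ∷ xs) f≤g = ℤ.+-mono-≤ (f≤g x) (∑-mono-≤ xs f≤g)

    ∑-zero : ∀ xs → ∑[ x ∈ xs ] 0ℤ ≡ 0ℤ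
    ∑-zero []       = refl
    ∑-zero (x ∷ xs) = trans (ℤ.+-identityˡ _) (∑-zero xs)

    ∑-const : ∀ xs c → ∑[ x ∈ xs ] c ≡ + length xs * c
    ∑-const []       c = refl
    ∑-const (x ∷ xs) c = begin
      c + ∑[ x ∈ xs ] c          ≡⟨ cong (_+_ c) (∑-const xs c) ⟩
      c + + length xs * c        ≡⟨ cong (_+ + length xs * c) (sym (ℤ.*-identityˡ c)) ⟩
      1ℤ * c + + length xs * c   ≡⟨ sym (ℤ.*-distribʳ-+ c 1ℤ (+ length xs)) ⟩
      + length (x ∷ xs) * c      ∎
      where open ≡-Reasoning

    ∑-distrib-+ : ∀ xs (f g : A → ℤ) → ∑[ x ∈ xs ] (f x + g x) ≡ ∑ xs f + ∑ xs g
    ∑-distrib-+ []       f g = refl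
    ∑-distrib-+ (x ∷ xs) f g = trans (cong (_+_ (f x + g x)) (∑-distrib-+ xs f g)) (interchange (f x) (g x) _ _)
      where
      interchange : ∀ a b c d → (a + b) + (c + d) ≡ (a + c) + (b + d)
      interchange = solve-∀

    *-distribˡ-∑ : ∀ c xs (f : A → ℤ) → c * ∑ xs f ≡ ∑[ x ∈ xs ] (c * f x)
    *-distribˡ-∑ c []       f = ℤ.*-zeroʳ c
    *-distribˡ-∑ c (x ∷ xs) f = trans (ℤ.*-distribˡ-+ c (f x) (∑ xs f)) (cong (_+_ (c * f x)) (*-distribˡ-∑ c xs f))

    *-distribʳ-∑ : ∀ c xs (f : A → ℤ) → ∑ xs f * c ≡ ∑[ x ∈ xs ] (f x * c)
    *-distribʳ-∑ c xs f = trans (ℤ.*-comm (∑ xs f) c) (trans (*-distribˡ-∑ c xs f) (∑-cong xs λ x → ℤ.*-comm c (f x)))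

    -‿distrib-∑ : ∀ xs (f : A → ℤ) → - ∑ xs f ≡ ∑[ x ∈ xs ] (- f x)
    -‿distrib-∑ []       f = refl
    -‿distrib-∑ (x ∷ xs) f = trans (ℤ.neg-distrib-+ (f x) (∑ xs f)) (cong (_+_ (- f x)) (-‿distrib-∑ xs f))

    ∑-distrib-- : ∀ xs (f g : A → ℤ) → ∑[ x ∈ xs ] (f x - g x) ≡ ∑ xs f - ∑ xs g
    ∑-distrib-- xs f g = trans (∑-distrib-+ xs f (λ x → - g x)) (cong (_+_ (∑ xs f)) (sym (-‿distrib-∑ xs g)))

    ∑-++ : ∀ xs ys (f : A → ℤ) → ∑ (xs ++ ys) f ≡ ∑ xs f + ∑ ys f
    ∑-++ []       ys f = sym (ℤ.+-identityˡ (∑ ys f))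
    ∑-++ (x ∷ xs) ys f = trans (cong (_+_ (f x)) (∑-++ xs ys f)) (sym (ℤ.+-assoc (f x) (∑ xs f) (∑ ys f)))

    count≡∑ : ∀ (p : A → Bool) xs → + count p xs ≡ ∑[ x ∈ xs ] ⟦ p x ⟧
    count≡∑ p []       = refl
    count≡∑ p (x ∷ xs) with p x
    ... | true  = trans (ℤ.pos-+ 1 (count p xs)) (cong (_+_ 1ℤ) (count≡∑ p xs))
    ... | false = trans (count≡∑ p xs) (sym (ℤ.+-identityˡ _))

    sum≡∑ : ∀ (g : A → ℕ) xs → + ℕ.sum (map g xs) ≡ ∑[ x ∈ xs ] (+ g x)
    sum≡∑ g []       = refl
    sum≡∑ g (x ∷ xs) = trans (ℤ.pos-+ (g x) _) (cong (_+_ (+ g x)) (sum≡∑ g xs))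

  ∑-map : ∀ {A B : Set} (g : A → B) xs (f : B → ℤ) → ∑ (map g xs) f ≡ ∑[ x ∈ xs ] f (g x)
  ∑-map g []       f = refl
  ∑-map g (x ∷ xs) f = cong (_+_ (f (g x))) (∑-map g xs f)

  module _ {A B : Set} where

    ∑-comm : ∀ xs ys (h : A → B → ℤ) → ∑[ x ∈ xs ] ∑[ y ∈ ys ] h x y ≡ ∑[ y ∈ ys ] ∑[ x ∈ xs ] h x y
    ∑-comm []       ys h = sym (∑-zero ys)
    ∑-comm (x ∷ xs) ys h = trans (cong (_+_ (∑ ys (h x))) (∑-comm xs ys h)) (sym (∑-distrib-+ ys (h x) _))

    ∑-⊗ : ∀ xs ys (f : A × B → ℤ) → ∑ (xs ⊗ ys) f ≡ ∑[ x ∈ xs ] ∑[ y ∈ ys ] f (x , y)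
    ∑-⊗ []       ys f = refl
    ∑-⊗ (x ∷ xs) ys f = trans (∑-++ (map (x ,_) ys) (xs ⊗ ys) f)
                              (cong₂ _+_ (∑-map (x ,_) ys f) (∑-⊗ xs ys f))

    ∑*∑ : ∀ xs ys (f : A → ℤ) (g : B → ℤ) → ∑ xs f * ∑ ys g ≡ ∑[ x ∈ xs ] ∑[ y ∈ ys ] (f x * g y)
    ∑*∑ xs ys f g = trans (*-distribʳ-∑ (∑ ys g) xs f) (∑-cong xs λ x → *-distribˡ-∑ (f x) ys g)

  module _ {A : Set} (xs : List A) where

    ∑∑-symmetric-≤ : ∀ (p : A → A → ℤ) →
      ∑[ i ∈ xs ] ∑[ j ∈ xs ] (p i j * p j i) ≤ ∑[ i ∈ xs ] ∑[ j ∈ xs ] (p i j * p i j)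
    ∑∑-symmetric-≤ p = ℤ.*-cancelˡ-≤-pos _ _ (+ 2) (begin
      + 2 * ∑[ i ∈ xs ] ∑[ j ∈ xs ] (p i j * p j i)
        ≡⟨ *-distribˡ-∑ (+ 2) xs _ ⟩
      ∑[ i ∈ xs ] (+ 2 * ∑[ j ∈ xs ] (p i j * p j i))
        ≡⟨ ∑-cong xs (λ i → *-distribˡ-∑ (+ 2) xs _) ⟩
      ∑[ i ∈ xs ] ∑[ j ∈ xs ] (+ 2 * (p i j * p j i))
        ≤⟨ ∑-mono-≤ xs (λ i → ∑-mono-≤ xs λ j → 2ij≤i*i+j*j (p i j) (p j i)) ⟩
      ∑[ i ∈ xs ] ∑[ j ∈ xs ] (p i j * p i j + p j i * p j i)
        ≡⟨ ∑-cong xs (λ i → ∑-distrib-+ xs _ _) ⟩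
      ∑[ i ∈ xs ] (∑[ j ∈ xs ] (p i j * p i j) + ∑[ j ∈ xs ] (p j i * p j i))
        ≡⟨ ∑-distrib-+ xs _ _ ⟩
      R + ∑[ i ∈ xs ] ∑[ j ∈ xs ] (p j i * p j i)
        ≡⟨ cong (_+_ R) (∑-comm xs xs (λ i j → p j i * p j i)) ⟩
      R + R
        ≡⟨ double R ⟩
      + 2 * R ∎)
      where
      open ℤ.≤-Reasoning
      R = ∑[ i ∈ xs ] ∑[ j ∈ xs ] (p i j * p i j)
      double : ∀ r → r + r ≡ + 2 * r
      double = solve-∀

    cauchy-schwarz : ∀ (f g : A → ℤ) →
      ∑[ x ∈ xs ] (f x * g x) * ∑[ x ∈ xs ] (f x * g x) ≤ ∑[ x ∈ xs ] (f x * f x) * ∑[ x ∈ xs ] (g x * g x)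
    cauchy-schwarz f g = subst₂ _≤_
      (sym (trans (∑*∑ xs xs _ _) (∑-cong xs λ i → ∑-cong xs λ j → swap-right (f i) (g i) (f j) (g j))))
      (sym (trans (∑*∑ xs xs _ _) (∑-cong xs λ i → ∑-cong xs λ j → swap-middle (f i) (f i) (g j) (g j))))
      (∑∑-symmetric-≤ λ i j → f i * g j)
      where
      swap-right : ∀ a b c d → (a * b) * (c * d) ≡ (a * d) * (c * b)
      swap-right = solve-∀
      swap-middle : ∀ a b c d → (a * b) * (c * d) ≡ (a * c) * (b * d)
      swap-middle = solve-∀

  module _ {A B C : Set} where

    ∑-rotate : ∀ (xs : List A) (ys : List B) (zs : List C) (h : A → B → C → ℤ) →
      ∑[ x ∈ xs ] ∑[ y ∈ ys ] ∑[ z ∈ zs ] h x y z ≡ ∑[ y ∈ ys ] ∑[ z ∈ zs ] ∑[ x ∈ xs ] h x y z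
    ∑-rotate xs ys zs h = trans (∑-comm xs ys _) (∑-cong ys λ y → ∑-comm xs zs λ x z → h x y z)

open IntegerSums

-- The ring solver decides coefficient equality by computation, which the field's
-- _≟_ cannot provide; so coefficients are integers, interpreted in R by ι.
module IntegerCoefficientSolver {c ℓ} (R : CommutativeRing c ℓ) where

  open import Algebra.Solver.Ring.AlmostCommutativeRing using (fromCommutativeRing; _-Raw-AlmostCommutative⟶_)
  open import Data.Integer as ℤ using (ℤ; +_; -[1+_]; _⊖_)
  import Data.Integer.Properties as ℤ
  open import Data.Maybe using (map)
  open import Data.Nat as ℕ using (zero; suc)
  import Data.Nat.Properties as ℕ
  open import Function using (_∘_)
  open import Relation.Nullary.Decidable using (dec⇒maybe)
  open import Relation.Binary.PropositionalEquality using (_≡_; cong)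

  open CommutativeRing R
  open import Algebra.Properties.Ring ring
    using (-0#≈0#; -‿involutive; -‿+-comm; xyx⁻¹≈y; -‿distribˡ-*; -‿distribʳ-*)
  open import Algebra.Properties.Semiring.Mult semiring using (_×_; ×-congˡ; ×-homo-+; ×1-homo-*)
  open import Relation.Binary.Reasoning.Setoid setoid

  ι : ℤ → Carrier
  ι (+ n)    = n × 1#
  ι -[1+ n ] = - (suc n × 1#)

  ι-cong : ∀ {i j} → i ≡ j → ι i ≈ ι j
  ι-cong = reflexive ∘ cong ι

  ι-neg : ∀ i → ι (ℤ.- i) ≈ - ι i
  ι-neg (+ zero)  = sym -0#≈0#
  ι-neg (+ suc n) = refl
  ι-neg -[1+ n ]  = sym (-‿involutive _)

  ι-⊖ : ∀ m n → ι (m ⊖ n) ≈ m × 1# - n × 1#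
  ι-⊖ m       zero    = sym (trans (+-congˡ -0#≈0#) (+-identityʳ _))
  ι-⊖ zero    (suc n) = sym (+-identityˡ _)
  ι-⊖ (suc m) (suc n) = begin
    ι (suc m ⊖ suc n)                  ≈⟨ ι-cong (ℤ.[1+m]⊖[1+n]≡m⊖n m n) ⟩
    ι (m ⊖ n)                          ≈⟨ ι-⊖ m n ⟩
    a - b                              ≈⟨ xyx⁻¹≈y 1# (a - b) ⟨
    1# + (a - b) - 1#                  ≈⟨ +-congʳ (+-assoc 1# a (- b)) ⟨
    1# + a - b - 1#                    ≈⟨ +-assoc (1# + a) (- b) (- 1#) ⟩
    (1# + a) + (- b - 1#)              ≈⟨ +-congˡ (+-comm (- b) (- 1#)) ⟩
    (1# + a) + (- 1# - b)              ≈⟨ +-congˡ (-‿+-comm 1# b) ⟩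
    (1# + a) - (1# + b)                ∎
    where
    a = m × 1#
    b = n × 1#

  ι-+ : ∀ i j → ι (i ℤ.+ j) ≈ ι i + ι j
  ι-+ (+ m)    (+ n)    = ×-homo-+ 1# m n
  ι-+ (+ m)    -[1+ n ] = ι-⊖ m (suc n)
  ι-+ -[1+ m ] (+ n)    = trans (ι-⊖ n (suc m)) (+-comm _ _)
  ι-+ -[1+ m ] -[1+ n ] = begin
    - (suc (suc (m ℕ.+ n)) × 1#)       ≈⟨ -‿cong (×-congˡ (cong suc (ℕ.+-suc m n))) ⟨
    - ((suc m ℕ.+ suc n) × 1#)         ≈⟨ -‿cong (×-homo-+ 1# (suc m) (suc n)) ⟩
    - (suc m × 1# + suc n × 1#)        ≈⟨ -‿+-comm _ _ ⟨
    - (suc m × 1#) - suc n × 1#        ∎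

  ι-pos-* : ∀ m n → ι (+ m ℤ.* + n) ≈ m × 1# * (n × 1#)
  ι-pos-* m n = trans (sym (ι-cong (ℤ.pos-* m n))) (×1-homo-* m n)

  ι-* : ∀ i j → ι (i ℤ.* j) ≈ ι i * ι j
  ι-* (+ m)    (+ n)    = ι-pos-* m n
  ι-* (+ m)    -[1+ n ] = begin
    ι (+ m ℤ.* ℤ.- + suc n)            ≈⟨ ι-cong (ℤ.neg-distribʳ-* (+ m) (+ suc n)) ⟨
    ι (ℤ.- (+ m ℤ.* + suc n))          ≈⟨ ι-neg (+ m ℤ.* + suc n) ⟩
    - ι (+ m ℤ.* + suc n)              ≈⟨ -‿cong (ι-pos-* m (suc n)) ⟩
    - (m × 1# * (suc n × 1#))          ≈⟨ -‿distribʳ-* _ _ ⟩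
    m × 1# * - (suc n × 1#)            ∎
  ι-* -[1+ m ] (+ n)    = begin
    ι (ℤ.- + suc m ℤ.* + n)            ≈⟨ ι-cong (ℤ.neg-distribˡ-* (+ suc m) (+ n)) ⟨
    ι (ℤ.- (+ suc m ℤ.* + n))          ≈⟨ ι-neg (+ suc m ℤ.* + n) ⟩
    - ι (+ suc m ℤ.* + n)              ≈⟨ -‿cong (ι-pos-* (suc m) n) ⟩
    - (suc m × 1# * (n × 1#))          ≈⟨ -‿distribˡ-* _ _ ⟩
    - (suc m × 1#) * (n × 1#)          ∎
  ι-* -[1+ m ] -[1+ n ] = begin
    ι (+ suc m ℤ.* + suc n)            ≈⟨ ι-pos-* (suc m) (suc n) ⟩
    suc m × 1# * (suc n × 1#)          ≈⟨ -‿involutive _ ⟨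
    - - (suc m × 1# * (suc n × 1#))    ≈⟨ -‿cong (-‿distribˡ-* _ _) ⟩
    - (- (suc m × 1#) * (suc n × 1#))  ≈⟨ -‿distribʳ-* _ _ ⟩
    - (suc m × 1#) * - (suc n × 1#)    ∎

  ι-homomorphism : ℤ.+-*-rawRing -Raw-AlmostCommutative⟶ fromCommutativeRing R
  ι-homomorphism = record
    { ⟦_⟧ = ι ; +-homo = ι-+ ; *-homo = ι-* ; -‿homo = ι-neg ; 0-homo = refl ; 1-homo = +-identityʳ 1# }

  open import Algebra.Solver.Ring ℤ.+-*-rawRing (fromCommutativeRing R) ι-homomorphism
    (λ i j → map ι-cong (dec⇒maybe (i ℤ.≟ j))) public

module FieldArithmetic (F : FiniteField) where

  open import Data.Product using (_,_)
  open import Relation.Binary.PropositionalEquality using (_≡_; _≢_; refl; sym; cong; cong₂; module ≡-Reasoning)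
  open ≡-Reasoning

  open FiniteField F

  commutativeRing : CommutativeRing _ _
  commutativeRing = record { isCommutativeRing = isCommutativeRing }

  open CommutativeRing commutativeRing public using (*-identityˡ; +-identityˡ; +-identityʳ; -‿inverseʳ; +-comm; distribʳ; zeroʳ)
  open IntegerCoefficientSolver commutativeRing public using (solve; _:+_; _:-_; _:*_; _:=_)

  infix 8 _²
  _² : Carrier → Carrier
  x ² = x * x

  a*x≡0⇒x≡0 : ∀ {a x} → a ≢ 0# → a * x ≡ 0# → x ≡ 0#
  a*x≡0⇒x≡0 {a} {x} a≢0 ax≡0 with inverse a a≢0
  ... | a⁻¹ , aa⁻¹≡1 = begin
    x                ≡⟨ sym (*-identityˡ x) ⟩
    1# * x           ≡⟨ cong (_* x) (sym aa⁻¹≡1) ⟩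
    (a * a⁻¹) * x    ≡⟨ solve 3 (λ a b x → (a :* b) :* x := b :* (a :* x)) refl a a⁻¹ x ⟩
    a⁻¹ * (a * x)    ≡⟨ cong (a⁻¹ *_) ax≡0 ⟩
    a⁻¹ * 0#         ≡⟨ zeroʳ a⁻¹ ⟩
    0#               ∎

  x-y≡0⇒x≡y : ∀ {x y} → x - y ≡ 0# → x ≡ y
  x-y≡0⇒x≡y {x} {y} x-y≡0 = begin
    x                ≡⟨ solve 2 (λ x y → x := (x :- y) :+ y) refl x y ⟩
    (x - y) + y      ≡⟨ cong (_+ y) x-y≡0 ⟩
    0# + y           ≡⟨ +-identityˡ y ⟩
    y                ∎

  x+x≡0⇒x≡0 : 1# + 1# ≢ 0# → ∀ {x} → x + x ≡ 0# → x ≡ 0#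
  x+x≡0⇒x≡0 2≢0 {x} x+x≡0 = a*x≡0⇒x≡0 2≢0 (begin
    (1# + 1#) * x    ≡⟨ distribʳ x 1# 1# ⟩
    1# * x + 1# * x  ≡⟨ cong₂ _+_ (*-identityˡ x) (*-identityˡ x) ⟩
    x + x            ≡⟨ x+x≡0 ⟩
    0#               ∎)

module FiniteFieldSums (F : FiniteField) where

  open import Data.Integer using (ℤ; +_; 0ℤ; 1ℤ)
    renaming (_+_ to _+ℤ_; _*_ to _*ℤ_; _-_ to _-ℤ_; _≤_ to _≤ℤ_)
  import Data.Integer.Properties as ℤ
  open import Data.Integer.Tactic.RingSolver using (solve-∀)
  open import Data.List using ([]; _∷_; length)
  open import Data.List.Membership.Propositional using (_∈_; _∉_)
  open import Data.List.Relation.Unary.All as All using (All)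
  open import Data.List.Relation.Unary.All.Properties using (All¬⇒¬Any)
  open import Data.List.Relation.Unary.AllPairs using (_∷_)
  open import Data.List.Relation.Unary.Unique.Propositional using (Unique)
  open import Data.List.Relation.Unary.Any using (here; there)
  open import Data.Product using (_,_)
  open import Function using (_∘_)
  open import Relation.Nullary using (yes; no; contradiction)
  open import Relation.Nullary.Decidable using (⌊_⌋)
  open import Relation.Binary.PropositionalEquality using (_≡_; _≢_; refl; sym; trans; cong; cong₂; module ≡-Reasoning)
  open ≡-Reasoning

  open FiniteField F

  open FieldArithmetic F

  ∑ᶠ : (Carrier → ℤ) → ℤ
  ∑ᶠ = ∑ elements

  syntax ∑ᶠ (λ x → e) = ∑[ x ] e

  q : ℤ
  q = + order

  δ : Carrier → Carrier → ℤ
  δ x y = ⟦ ⌊ x ≟ y ⌋ ⟧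

  δ-cong : ∀ {x y x′ y′} → (x ≡ y → x′ ≡ y′) → (x′ ≡ y′ → x ≡ y) → δ x y ≡ δ x′ y′
  δ-cong {x} {y} {x′} {y′} to from with x ≟ y | x′ ≟ y′
  ... | yes _    | yes _     = refl
  ... | no _     | no _      = refl
  ... | yes x≡y  | no x′≢y′  = contradiction (to x≡y) x′≢y′
  ... | no x≢y   | yes x′≡y′ = contradiction (from x′≡y′) x≢y

  δ-refl : ∀ x → δ x x ≡ 1ℤ
  δ-refl x with x ≟ x
  ... | yes _   = refl
  ... | no x≢x  = contradiction refl x≢x

  δ-≢ : ∀ {x y} → x ≢ y → δ x y ≡ 0ℤ
  δ-≢ {x} {y} x≢y with x ≟ y
  ... | yes x≡y = contradiction x≡y x≢y
  ... | no _    = refl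

  ∑-δ : ∀ y (g : Carrier → ℤ) → ∑[ x ] (δ x y *ℤ g x) ≡ g y
  ∑-δ y g = sift unique (complete y)
    where
    vanish : ∀ {xs} → y ∉ xs → ∑[ x ∈ xs ] (δ x y *ℤ g x) ≡ 0ℤ
    vanish {[]}     y∉xs = refl
    vanish {x ∷ xs} y∉xs = trans
      (cong₂ _+ℤ_ (cong (_*ℤ g x) (δ-≢ λ x≡y → y∉xs (here (sym x≡y)))) (vanish (y∉xs ∘ there)))
      (ℤ.+-identityˡ 0ℤ)

    sift : ∀ {xs} → Unique xs → y ∈ xs → ∑[ x ∈ xs ] (δ x y *ℤ g x) ≡ g y
    sift (y≢xs ∷ _) (here refl) = trans
      (cong₂ _+ℤ_ (trans (cong (_*ℤ g y) (δ-refl y)) (ℤ.*-identityˡ (g y))) (vanish (All¬⇒¬Any y≢xs)))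
      (ℤ.+-identityʳ (g y))
    sift {x ∷ _} (x≢xs ∷ u) (there y∈xs) = trans
      (cong₂ _+ℤ_ (cong (_*ℤ g x) (δ-≢ (All.lookup x≢xs y∈xs))) (sift u y∈xs))
      (ℤ.+-identityˡ (g y))

  ∑-reindex : ∀ (σ τ : Carrier → Carrier) → (∀ y → σ (τ y) ≡ y) → (∀ x → τ (σ x) ≡ x) →
              ∀ f → ∑[ x ] f (σ x) ≡ ∑ᶠ f
  ∑-reindex σ τ στ τσ f = begin
    ∑[ x ] f (σ x)
      ≡⟨ ∑-cong elements (λ x → sym (∑-δ (σ x) (λ _ → f (σ x)))) ⟩
    ∑[ x ] ∑[ y ] (δ y (σ x) *ℤ f (σ x))
      ≡⟨ ∑-cong elements (λ x → ∑-cong elements λ y → cong (_*ℤ f (σ x)) (δ-graph x y)) ⟩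
    ∑[ x ] ∑[ y ] (δ x (τ y) *ℤ f (σ x))
      ≡⟨ ∑-comm elements elements _ ⟩
    ∑[ y ] ∑[ x ] (δ x (τ y) *ℤ f (σ x))
      ≡⟨ ∑-cong elements (λ y → trans (∑-δ (τ y) (f ∘ σ)) (cong f (στ y))) ⟩
    ∑ᶠ f ∎
    where
    δ-graph : ∀ x y → δ y (σ x) ≡ δ x (τ y)
    δ-graph x y = δ-cong (λ y≡σx → trans (sym (τσ x)) (cong τ (sym y≡σx)))
                         (λ x≡τy → trans (sym (στ y)) (cong σ (sym x≡τy)))

  ∑-affine : ∀ {α} β → α ≢ 0# → ∀ f → ∑[ x ] f (α * x + β) ≡ ∑ᶠ f
  ∑-affine {α} β α≢0 f with inverse α α≢0
  ... | α⁻¹ , αα⁻¹≡1 = ∑-reindex (λ x → α * x + β) (λ y → α⁻¹ * (y - β)) cancel-right cancel-left f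
    where
    cancel-right : ∀ y → α * (α⁻¹ * (y - β)) + β ≡ y
    cancel-right y = begin
      α * (α⁻¹ * (y - β)) + β  ≡⟨ solve 4 (λ a b y β → a :* (b :* (y :- β)) :+ β := (a :* b) :* (y :- β) :+ β)
                                          refl α α⁻¹ y β ⟩
      (α * α⁻¹) * (y - β) + β  ≡⟨ cong (λ c → c * (y - β) + β) αα⁻¹≡1 ⟩
      1# * (y - β) + β         ≡⟨ cong (_+ β) (*-identityˡ (y - β)) ⟩
      (y - β) + β              ≡⟨ solve 2 (λ y β → (y :- β) :+ β := y) refl y β ⟩
      y                        ∎
    cancel-left : ∀ x → α⁻¹ * ((α * x + β) - β) ≡ x
    cancel-left x = begin
      α⁻¹ * ((α * x + β) - β)  ≡⟨ solve 4 (λ a b x β → b :* ((a :* x :+ β) :- β) := (a :* b) :* x) refl α α⁻¹ x β ⟩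
      (α * α⁻¹) * x            ≡⟨ cong (_* x) αα⁻¹≡1 ⟩
      1# * x                   ≡⟨ *-identityˡ x ⟩
      x                        ∎

  ∑-shift : ∀ k f → ∑[ x ] f (x + k) ≡ ∑ᶠ f
  ∑-shift k f = trans (∑-cong elements λ x → cong (λ y → f (y + k)) (sym (*-identityˡ x))) (∑-affine k 1≢0 f)
    where
    1≢0 : 1# ≢ 0#
    1≢0 1≡0 = 0≢1 (sym 1≡0)

  ∑-shiftˡ : ∀ k f → ∑[ x ] f (k + x) ≡ ∑ᶠ f
  ∑-shiftˡ k f = trans (∑-cong elements λ x → cong f (+-comm k x)) (∑-shift k f)

  ∑-reflect : ∀ k f → ∑[ x ] f (k - x) ≡ ∑ᶠ f
  ∑-reflect k f = ∑-reindex (_-_ k) (_-_ k) involutive involutive f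
    where
    involutive : ∀ y → k - (k - y) ≡ y
    involutive y = solve 2 (λ k y → k :- (k :- y) := y) refl k y

  ∑∑-offDiagonal : ∀ (T : Carrier → Carrier → ℤ) (g : Carrier → ℤ) →
    (∀ {v v′} → v ≢ v′ → T v v′ ≡ g v *ℤ g v′) →
    ∑[ v ] ∑[ v′ ] T v v′ ≡ ∑[ v ] (T v v -ℤ g v *ℤ g v) +ℤ ∑ᶠ g *ℤ ∑ᶠ g
  ∑∑-offDiagonal T g T≡gg = begin
    ∑[ v ] ∑[ v′ ] T v v′
      ≡⟨ ∑-cong elements (λ v → ∑-cong elements (split v)) ⟩
    ∑[ v ] ∑[ v′ ] (δ v′ v *ℤ X v +ℤ g v *ℤ g v′)
      ≡⟨ ∑-cong elements (λ v → ∑-distrib-+ elements _ _) ⟩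
    ∑[ v ] (∑[ v′ ] (δ v′ v *ℤ X v) +ℤ ∑[ v′ ] (g v *ℤ g v′))
      ≡⟨ ∑-cong elements (λ v → cong₂ _+ℤ_ (∑-δ v (λ _ → X v)) (sym (*-distribˡ-∑ (g v) elements g))) ⟩
    ∑[ v ] (X v +ℤ g v *ℤ ∑ᶠ g)
      ≡⟨ ∑-distrib-+ elements _ _ ⟩
    ∑ᶠ X +ℤ ∑[ v ] (g v *ℤ ∑ᶠ g)
      ≡⟨ cong (∑ᶠ X +ℤ_) (sym (*-distribʳ-∑ (∑ᶠ g) elements g)) ⟩
    ∑ᶠ X +ℤ ∑ᶠ g *ℤ ∑ᶠ g ∎
    where
    X : Carrier → ℤ
    X v = T v v -ℤ g v *ℤ g v
    split : ∀ v v′ → T v v′ ≡ δ v′ v *ℤ X v +ℤ g v *ℤ g v′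
    split v v′ with v′ ≟ v
    ... | yes refl = diagonal (T v v) (g v *ℤ g v)
      where
      diagonal : ∀ a b → a ≡ 1ℤ *ℤ (a -ℤ b) +ℤ b
      diagonal = solve-∀
    ... | no v′≢v  = trans (T≡gg (v′≢v ∘ sym)) (sym (ℤ.+-identityˡ _))

  ∑-linear : ∀ a b c (g h : Carrier → ℤ) →
    ∑[ x ] (a *ℤ g x +ℤ b *ℤ h x +ℤ c) ≡ a *ℤ ∑ᶠ g +ℤ b *ℤ ∑ᶠ h +ℤ q *ℤ c
  ∑-linear a b c g h = begin
    ∑[ x ] (a *ℤ g x +ℤ b *ℤ h x +ℤ c)             ≡⟨ ∑-distrib-+ elements _ _ ⟩
    ∑[ x ] (a *ℤ g x +ℤ b *ℤ h x) +ℤ ∑[ x ] c      ≡⟨ cong₂ _+ℤ_ (∑-distrib-+ elements _ _) (∑-const elements c) ⟩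
    ∑[ x ] (a *ℤ g x) +ℤ ∑[ x ] (b *ℤ h x) +ℤ q *ℤ c
      ≡⟨ cong (_+ℤ q *ℤ c) (sym (cong₂ _+ℤ_ (*-distribˡ-∑ a elements g) (*-distribˡ-∑ b elements h))) ⟩
    a *ℤ ∑ᶠ g +ℤ b *ℤ ∑ᶠ h +ℤ q *ℤ c                ∎

  q-cancelˡ-≤ : ∀ {i j} → q *ℤ i ≤ℤ q *ℤ j → i ≤ℤ j
  q-cancelˡ-≤ {i} {j} with elements | complete 0#
  ... | []     | ()
  ... | x ∷ xs | _  = ℤ.*-cancelˡ-≤-pos i j (+ length (x ∷ xs))

module Correlations (F : FiniteField) where

  open import Data.Integer using (ℤ; +_; 0ℤ)
    renaming (_+_ to _+ℤ_; _*_ to _*ℤ_; _-_ to _-ℤ_; -_ to -ℤ_; _≤_ to _≤ℤ_)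
  import Data.Integer.Properties as ℤ
  open import Data.Integer.Tactic.RingSolver using (solve-∀)
  open import Relation.Binary.PropositionalEquality using (_≡_; refl; sym; trans; cong; cong₂; module ≡-Reasoning)

  open FiniteField F
  open FieldArithmetic F
  open FiniteFieldSums F

  correlation : (Carrier → ℤ) → (Carrier → ℤ) → Carrier → ℤ
  correlation g h t = ∑[ x ] (g x *ℤ h (x - t))

  convolution : (Carrier → ℤ) → (Carrier → ℤ) → Carrier → ℤ
  convolution g h t = ∑[ c ] (g c *ℤ h (t - c))

  autocorrelation : (Carrier → ℤ) → Carrier → ℤ
  autocorrelation g z = ∑[ c ] (g c *ℤ g (c + z))

  ∑-correlation : ∀ g h → ∑[ t ] correlation g h t ≡ ∑ᶠ g *ℤ ∑ᶠ h
  ∑-correlation g h = begin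
    ∑[ t ] ∑[ x ] (g x *ℤ h (x - t))     ≡⟨ ∑-comm elements elements _ ⟩
    ∑[ x ] ∑[ t ] (g x *ℤ h (x - t))     ≡⟨ ∑-cong elements (λ x → sym (*-distribˡ-∑ (g x) elements _)) ⟩
    ∑[ x ] (g x *ℤ ∑[ t ] h (x - t))     ≡⟨ ∑-cong elements (λ x → cong (g x *ℤ_) (∑-reflect x h)) ⟩
    ∑[ x ] (g x *ℤ ∑ᶠ h)                 ≡⟨ sym (*-distribʳ-∑ (∑ᶠ h) elements g) ⟩
    ∑ᶠ g *ℤ ∑ᶠ h                         ∎
    where open ≡-Reasoning

  ∑-autocorrelation : ∀ g → ∑[ z ] autocorrelation g z ≡ ∑ᶠ g *ℤ ∑ᶠ g
  ∑-autocorrelation g = begin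
    ∑[ z ] ∑[ c ] (g c *ℤ g (c + z))     ≡⟨ ∑-comm elements elements _ ⟩
    ∑[ c ] ∑[ z ] (g c *ℤ g (c + z))     ≡⟨ ∑-cong elements (λ c → sym (*-distribˡ-∑ (g c) elements _)) ⟩
    ∑[ c ] (g c *ℤ ∑[ z ] g (c + z))     ≡⟨ ∑-cong elements (λ c → cong (g c *ℤ_) (∑-shiftˡ c g)) ⟩
    ∑[ c ] (g c *ℤ ∑ᶠ g)                 ≡⟨ sym (*-distribʳ-∑ (∑ᶠ g) elements g) ⟩
    ∑ᶠ g *ℤ ∑ᶠ g                         ∎
    where open ≡-Reasoning

  correlation-affineʳ : ∀ g h α β t →
    correlation g (λ d → α *ℤ h d -ℤ β) t ≡ α *ℤ correlation g h t -ℤ β *ℤ ∑ᶠ g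
  correlation-affineʳ g h α β t = begin
    ∑[ x ] (g x *ℤ (α *ℤ h (x - t) -ℤ β))
      ≡⟨ ∑-cong elements (λ x → expand α β (g x) (h (x - t))) ⟩
    ∑[ x ] (α *ℤ (g x *ℤ h (x - t)) +ℤ -ℤ β *ℤ g x +ℤ 0ℤ)
      ≡⟨ ∑-linear α (-ℤ β) 0ℤ _ g ⟩
    α *ℤ correlation g h t +ℤ -ℤ β *ℤ ∑ᶠ g +ℤ q *ℤ 0ℤ
      ≡⟨ collect α (correlation g h t) β (∑ᶠ g) q ⟩
    α *ℤ correlation g h t -ℤ β *ℤ ∑ᶠ g ∎
    where
    open ≡-Reasoning
    expand : ∀ α β a b → a *ℤ (α *ℤ b -ℤ β) ≡ α *ℤ (a *ℤ b) +ℤ -ℤ β *ℤ a +ℤ 0ℤ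
    expand = solve-∀
    collect : ∀ α c β s q → α *ℤ c +ℤ -ℤ β *ℤ s +ℤ q *ℤ 0ℤ ≡ α *ℤ c -ℤ β *ℤ s
    collect = solve-∀

  autocorrelation-affine : ∀ h α β z →
    autocorrelation (λ d → α *ℤ h d -ℤ β) z
      ≡ α *ℤ α *ℤ autocorrelation h z -ℤ + 2 *ℤ α *ℤ β *ℤ ∑ᶠ h +ℤ q *ℤ β *ℤ β
  autocorrelation-affine h α β z = begin
    ∑[ c ] ((α *ℤ h c -ℤ β) *ℤ (α *ℤ h (c + z) -ℤ β))
      ≡⟨ ∑-cong elements (λ c → expand α β (h c) (h (c + z))) ⟩
    ∑[ c ] (α *ℤ α *ℤ (h c *ℤ h (c + z)) +ℤ -ℤ (α *ℤ β) *ℤ (h c +ℤ h (c + z)) +ℤ β *ℤ β)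
      ≡⟨ ∑-linear (α *ℤ α) (-ℤ (α *ℤ β)) (β *ℤ β) _ _ ⟩
    α *ℤ α *ℤ autocorrelation h z +ℤ -ℤ (α *ℤ β) *ℤ ∑[ c ] (h c +ℤ h (c + z)) +ℤ q *ℤ (β *ℤ β)
      ≡⟨ cong (λ s → α *ℤ α *ℤ autocorrelation h z +ℤ -ℤ (α *ℤ β) *ℤ s +ℤ q *ℤ (β *ℤ β))
              (trans (∑-distrib-+ elements h _) (cong (∑ᶠ h +ℤ_) (∑-shift z h))) ⟩
    α *ℤ α *ℤ autocorrelation h z +ℤ -ℤ (α *ℤ β) *ℤ (∑ᶠ h +ℤ ∑ᶠ h) +ℤ q *ℤ (β *ℤ β)
      ≡⟨ collect α β (autocorrelation h z) (∑ᶠ h) q ⟩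
    α *ℤ α *ℤ autocorrelation h z -ℤ + 2 *ℤ α *ℤ β *ℤ ∑ᶠ h +ℤ q *ℤ β *ℤ β ∎
    where
    open ≡-Reasoning
    expand : ∀ α β a b → (α *ℤ a -ℤ β) *ℤ (α *ℤ b -ℤ β)
                       ≡ α *ℤ α *ℤ (a *ℤ b) +ℤ -ℤ (α *ℤ β) *ℤ (a +ℤ b) +ℤ β *ℤ β
    expand = solve-∀
    collect : ∀ α β c s q → α *ℤ α *ℤ c +ℤ -ℤ (α *ℤ β) *ℤ (s +ℤ s) +ℤ q *ℤ (β *ℤ β)
                          ≡ α *ℤ α *ℤ c -ℤ + 2 *ℤ α *ℤ β *ℤ s +ℤ q *ℤ β *ℤ β
    collect = solve-∀

  ∑-correlation*correlation : ∀ g₁ h₁ g₂ h₂ →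
    ∑[ t ] (correlation g₁ h₁ t *ℤ correlation g₂ h₂ t) ≡ ∑[ t ] (convolution g₁ h₂ t *ℤ convolution g₂ h₁ t)
  ∑-correlation*correlation g₁ h₁ g₂ h₂ = begin
    ∑[ t ] (correlation g₁ h₁ t *ℤ correlation g₂ h₂ t)
      ≡⟨ ∑-cong elements (λ t → ∑*∑ elements elements _ _) ⟩
    ∑[ t ] ∑[ x ] ∑[ y ] ((g₁ x *ℤ h₁ (x - t)) *ℤ (g₂ y *ℤ h₂ (y - t)))
      ≡⟨ ∑-rotate elements elements elements _ ⟩
    ∑[ x ] ∑[ y ] ∑[ t ] ((g₁ x *ℤ h₁ (x - t)) *ℤ (g₂ y *ℤ h₂ (y - t)))
      ≡⟨ ∑-cong elements (λ x → ∑-cong elements λ y → reflect-at x y) ⟩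
    ∑[ x ] ∑[ y ] ∑[ t ] ((g₁ x *ℤ h₂ (t - x)) *ℤ (g₂ y *ℤ h₁ (t - y)))
      ≡⟨ sym (∑-rotate elements elements elements _) ⟩
    ∑[ t ] ∑[ x ] ∑[ y ] ((g₁ x *ℤ h₂ (t - x)) *ℤ (g₂ y *ℤ h₁ (t - y)))
      ≡⟨ sym (∑-cong elements λ t → ∑*∑ elements elements _ _) ⟩
    ∑[ t ] (convolution g₁ h₂ t *ℤ convolution g₂ h₁ t) ∎
    where
    open ≡-Reasoning
    swap-right : ∀ a b c d → (a *ℤ b) *ℤ (c *ℤ d) ≡ (a *ℤ d) *ℤ (c *ℤ b)
    swap-right = solve-∀
    -- t ↦ (x + y) - t exchanges x - t with t - y and y - t with t - x
    reflect-at : ∀ x y → ∑[ t ] ((g₁ x *ℤ h₁ (x - t)) *ℤ (g₂ y *ℤ h₂ (y - t)))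
                       ≡ ∑[ t ] ((g₁ x *ℤ h₂ (t - x)) *ℤ (g₂ y *ℤ h₁ (t - y)))
    reflect-at x y = trans (∑-cong elements pointwise) (∑-reflect (x + y) _)
      where
      pointwise : ∀ t → (g₁ x *ℤ h₁ (x - t)) *ℤ (g₂ y *ℤ h₂ (y - t))
                      ≡ (g₁ x *ℤ h₂ ((x + y - t) - x)) *ℤ (g₂ y *ℤ h₁ ((x + y - t) - y))
      pointwise t = trans (swap-right (g₁ x) (h₁ (x - t)) (g₂ y) (h₂ (y - t)))
        (sym (cong₂ (λ u w → (g₁ x *ℤ h₂ u) *ℤ (g₂ y *ℤ h₁ w))
                    (solve 3 (λ x y t → (x :+ y :- t) :- x := y :- t) refl x y t)
                    (solve 3 (λ x y t → (x :+ y :- t) :- y := x :- t) refl x y t)))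

  ∑-convolution² : ∀ g h →
    ∑[ t ] (convolution g h t *ℤ convolution g h t) ≡ ∑[ z ] (autocorrelation g z *ℤ autocorrelation h z)
  ∑-convolution² g h = begin
    ∑[ t ] (convolution g h t *ℤ convolution g h t)
      ≡⟨ ∑-cong elements (λ t → ∑*∑ elements elements _ _) ⟩
    ∑[ t ] ∑[ c ] ∑[ c′ ] ((g c *ℤ h (t - c)) *ℤ (g c′ *ℤ h (t - c′)))
      ≡⟨ ∑-rotate elements elements elements _ ⟩
    ∑[ c ] ∑[ c′ ] ∑[ t ] ((g c *ℤ h (t - c)) *ℤ (g c′ *ℤ h (t - c′)))
      ≡⟨ ∑-cong elements (λ c → sym (∑-shiftˡ c _)) ⟩
    ∑[ c ] ∑[ z ] ∑[ t ] ((g c *ℤ h (t - c)) *ℤ (g (c + z) *ℤ h (t - (c + z))))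
      ≡⟨ ∑-cong elements (λ c → ∑-cong elements λ z → sym (substitute c z)) ⟩
    ∑[ c ] ∑[ z ] ∑[ d ] ((g c *ℤ g (c + z)) *ℤ (h d *ℤ h (d + z)))
      ≡⟨ ∑-comm elements elements _ ⟩
    ∑[ z ] ∑[ c ] ∑[ d ] ((g c *ℤ g (c + z)) *ℤ (h d *ℤ h (d + z)))
      ≡⟨ sym (∑-cong elements λ z → ∑*∑ elements elements _ _) ⟩
    ∑[ z ] (autocorrelation g z *ℤ autocorrelation h z) ∎
    where
    open ≡-Reasoning
    swap-inner : ∀ a b c d → (a *ℤ b) *ℤ (c *ℤ d) ≡ (a *ℤ d) *ℤ (b *ℤ c)
    swap-inner = solve-∀
    substitute : ∀ c z → ∑[ d ] ((g c *ℤ g (c + z)) *ℤ (h d *ℤ h (d + z)))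
                       ≡ ∑[ t ] ((g c *ℤ h (t - c)) *ℤ (g (c + z) *ℤ h (t - (c + z))))
    substitute c z = trans (∑-cong elements pointwise) (∑-shift (c + z) _)
      where
      pointwise : ∀ d → (g c *ℤ g (c + z)) *ℤ (h d *ℤ h (d + z))
                      ≡ (g c *ℤ h ((d + (c + z)) - c)) *ℤ (g (c + z) *ℤ h ((d + (c + z)) - (c + z)))
      pointwise d = trans (swap-inner (g c) (g (c + z)) (h d) (h (d + z)))
        (sym (cong₂ (λ u w → (g c *ℤ h u) *ℤ (g (c + z) *ℤ h w))
                    (solve 3 (λ d c z → (d :+ (c :+ z)) :- c := d :+ z) refl d c z)
                    (solve 3 (λ d c z → (d :+ (c :+ z)) :- (c :+ z) := d) refl d c z)))

  correlation-energy-≤ : ∀ (a b : Carrier → Carrier → ℤ) →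
    ∑[ t ] (∑[ u ] correlation (a u) (b u) t *ℤ ∑[ u ] correlation (a u) (b u) t)
      ≤ℤ ∑[ z ] (∑[ u ] autocorrelation (a u) z *ℤ ∑[ w ] autocorrelation (b w) z)
  correlation-energy-≤ a b = begin
    ∑[ t ] (∑[ u ] X u t *ℤ ∑[ w ] X w t)
      ≡⟨ ∑-cong elements (λ t → ∑*∑ elements elements _ _) ⟩
    ∑[ t ] ∑[ u ] ∑[ w ] (X u t *ℤ X w t)
      ≡⟨ ∑-rotate elements elements elements _ ⟩
    ∑[ u ] ∑[ w ] ∑[ t ] (X u t *ℤ X w t)
      ≡⟨ ∑-cong elements (λ u → ∑-cong elements λ w → ∑-correlation*correlation (a u) (b u) (a w) (b w)) ⟩
    ∑[ u ] ∑[ w ] ∑[ t ] (P u w t *ℤ P w u t)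
      ≡⟨ sym (∑-rotate elements elements elements _) ⟩
    ∑[ t ] ∑[ u ] ∑[ w ] (P u w t *ℤ P w u t)
      ≤⟨ ∑-mono-≤ elements (λ t → ∑∑-symmetric-≤ elements λ u w → P u w t) ⟩
    ∑[ t ] ∑[ u ] ∑[ w ] (P u w t *ℤ P u w t)
      ≡⟨ ∑-rotate elements elements elements _ ⟩
    ∑[ u ] ∑[ w ] ∑[ t ] (P u w t *ℤ P u w t)
      ≡⟨ ∑-cong elements (λ u → ∑-cong elements λ w → ∑-convolution² (a u) (b w)) ⟩
    ∑[ u ] ∑[ w ] ∑[ z ] (autocorrelation (a u) z *ℤ autocorrelation (b w) z)
      ≡⟨ sym (∑-rotate elements elements elements _) ⟩
    ∑[ z ] ∑[ u ] ∑[ w ] (autocorrelation (a u) z *ℤ autocorrelation (b w) z)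
      ≡⟨ sym (∑-cong elements λ z → ∑*∑ elements elements _ _) ⟩
    ∑[ z ] (∑[ u ] autocorrelation (a u) z *ℤ ∑[ w ] autocorrelation (b w) z) ∎
    where
    open ℤ.≤-Reasoning
    X : Carrier → Carrier → ℤ
    X u = correlation (a u) (b u)
    P : Carrier → Carrier → Carrier → ℤ
    P u w = convolution (a u) (b w)

  ∑-autocorrelation*autocorrelation : ∀ g h →
    ∑[ z ] (autocorrelation g z *ℤ autocorrelation h z)
      ≡ ∑[ x ] ∑[ x′ ] ∑[ y ] ((g x *ℤ g x′) *ℤ (h y *ℤ h (x + y - x′)))
  ∑-autocorrelation*autocorrelation g h = begin
    ∑[ z ] (autocorrelation g z *ℤ autocorrelation h z)
      ≡⟨ ∑-cong elements (λ z → ∑*∑ elements elements _ _) ⟩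
    ∑[ z ] ∑[ c ] ∑[ d ] ((g c *ℤ g (c + z)) *ℤ (h d *ℤ h (d + z)))
      ≡⟨ ∑-comm elements elements _ ⟩
    ∑[ c ] ∑[ z ] ∑[ d ] ((g c *ℤ g (c + z)) *ℤ (h d *ℤ h (d + z)))
      ≡⟨ ∑-cong elements (λ c → sym (∑-shift (- c) _)) ⟩
    ∑[ c ] ∑[ x′ ] ∑[ d ] ((g c *ℤ g (c + (x′ - c))) *ℤ (h d *ℤ h (d + (x′ - c))))
      ≡⟨ ∑-cong elements (λ c → ∑-cong elements λ x′ → sym (trans (∑-cong elements (pointwise c x′)) (∑-shift (c - x′) _))) ⟩
    ∑[ c ] ∑[ x′ ] ∑[ y ] ((g c *ℤ g x′) *ℤ (h y *ℤ h (c + y - x′))) ∎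
    where
    open ≡-Reasoning
    pointwise : ∀ c x′ y → (g c *ℤ g x′) *ℤ (h y *ℤ h (c + y - x′))
      ≡ (g c *ℤ g (c + (x′ - c))) *ℤ (h (y + (c - x′)) *ℤ h (y + (c - x′) + (x′ - c)))
    pointwise c x′ y = begin
      (g c *ℤ g x′) *ℤ (h y *ℤ h (c + y - x′))
        ≡⟨ cong ((g c *ℤ g x′) *ℤ_) (ℤ.*-comm (h y) (h (c + y - x′))) ⟩
      (g c *ℤ g x′) *ℤ (h (c + y - x′) *ℤ h y)
        ≡⟨ cong₂ (λ a b → (g c *ℤ g a) *ℤ (h b *ℤ h y))
                 (solve 2 (λ c x′ → x′ := c :+ (x′ :- c)) refl c x′)
                 (solve 3 (λ c x′ y → c :+ y :- x′ := y :+ (c :- x′)) refl c x′ y) ⟩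
      (g c *ℤ g (c + (x′ - c))) *ℤ (h (y + (c - x′)) *ℤ h y)
        ≡⟨ cong (λ b → (g c *ℤ g (c + (x′ - c))) *ℤ (h (y + (c - x′)) *ℤ h b))
                (solve 3 (λ c x′ y → y := y :+ (c :- x′) :+ (x′ :- c)) refl c x′ y) ⟩
      (g c *ℤ g (c + (x′ - c))) *ℤ (h (y + (c - x′)) *ℤ h (y + (c - x′) + (x′ - c))) ∎

module ParabolicEnergy (F : FiniteField) (f : FiniteField.Carrier F → FiniteField.Carrier F → ℤ) where

  open FiniteField F

  open import Data.Integer as ℤ using (+_; 0ℤ; 1ℤ; _^_)
    renaming (_+_ to _+ℤ_; _*_ to _*ℤ_; _-_ to _-ℤ_; -_ to -ℤ_; _≤_ to _≤ℤ_)
  import Data.Integer.Properties as ℤ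
  open import Data.Integer.Tactic.RingSolver using (solve-∀)
  open import Relation.Binary.PropositionalEquality using (_≡_; _≢_; refl; sym; trans; cong; cong₂; module ≡-Reasoning)

  open FieldArithmetic F
  open FiniteFieldSums F
  open Correlations F

  fiberMass : Carrier → ℤ
  fiberMass u = ∑ᶠ (f u)

  mass : ℤ
  mass = ∑ᶠ fiberMass

  fiberSquares : ℤ
  fiberSquares = ∑[ u ] (fiberMass u *ℤ fiberMass u)

  private
    N : ℤ
    N = mass *ℤ mass

  parabolaMass : Carrier → Carrier → ℤ
  parabolaMass w d = ∑[ v ] f v (d + (w - v) ²)

  -- x and y are at parabolic distance t iff y lies on the parabola with vertex (x₁ , x₂ - t),
  -- so for an indicator f this is ν t.
  distanceMass : Carrier → ℤ
  distanceMass t = ∑[ u ] correlation (f u) (parabolaMass u) t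

  fiberCorrelation : Carrier → ℤ
  fiberCorrelation z = ∑[ u ] autocorrelation (f u) z

  ∑-parabolaMass : ∀ w → ∑ᶠ (parabolaMass w) ≡ mass
  ∑-parabolaMass w = trans (∑-comm elements elements _) (∑-cong elements λ v → ∑-shift ((w - v) ²) (f v))

  ∑-distanceMass : ∑ᶠ distanceMass ≡ mass *ℤ mass
  ∑-distanceMass = begin
    ∑[ t ] ∑[ u ] correlation (f u) (parabolaMass u) t
      ≡⟨ ∑-comm elements elements _ ⟩
    ∑[ u ] ∑[ t ] correlation (f u) (parabolaMass u) t
      ≡⟨ ∑-cong elements (λ u → trans (∑-correlation (f u) (parabolaMass u)) (cong (fiberMass u *ℤ_) (∑-parabolaMass u))) ⟩
    ∑[ u ] (fiberMass u *ℤ mass)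
      ≡⟨ sym (*-distribʳ-∑ mass elements fiberMass) ⟩
    mass *ℤ mass ∎
    where open ≡-Reasoning

  ∑-fiberCorrelation : ∑ᶠ fiberCorrelation ≡ fiberSquares
  ∑-fiberCorrelation = trans (∑-comm elements elements _) (∑-cong elements λ u → ∑-autocorrelation (f u))

  parabolaOverlap : Carrier → Carrier → Carrier → ℤ
  parabolaOverlap v v′ z = ∑[ w ] ∑[ d ] (f v (d + (w - v) ²) *ℤ f v′ (d + z + (w - v′) ²))

  parabolaOverlap-diagonal : ∀ v z → parabolaOverlap v v z ≡ q *ℤ autocorrelation (f v) z
  parabolaOverlap-diagonal v z = trans (∑-cong elements shift-vertex) (∑-const elements _)
    where
    shift-vertex : ∀ w → ∑[ d ] (f v (d + (w - v) ²) *ℤ f v (d + z + (w - v) ²)) ≡ autocorrelation (f v) z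
    shift-vertex w = trans
      (∑-cong elements λ d → cong (λ e → f v (d + (w - v) ²) *ℤ f v e)
                                  (solve 3 (λ d z s → d :+ z :+ s := d :+ s :+ z) refl d z ((w - v) ²)))
      (∑-shift ((w - v) ²) (λ c → f v c *ℤ f v (c + z)))

  parabolaOverlap-offDiagonal : 1# + 1# ≢ 0# → ∀ z {v v′} → v ≢ v′ →
                                parabolaOverlap v v′ z ≡ fiberMass v *ℤ fiberMass v′
  parabolaOverlap-offDiagonal 2≢0 z {v} {v′} v≢v′ = begin
    ∑[ w ] ∑[ d ] (f v (d + (w - v) ²) *ℤ f v′ (d + z + (w - v′) ²))
      ≡⟨ ∑-cong elements shift-vertex ⟩
    ∑[ w ] ∑[ e ] (f v e *ℤ f v′ (α * w + (e + z + β)))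
      ≡⟨ ∑-comm elements elements _ ⟩
    ∑[ e ] ∑[ w ] (f v e *ℤ f v′ (α * w + (e + z + β)))
      ≡⟨ ∑-cong elements (λ e → trans (sym (*-distribˡ-∑ (f v e) elements _))
                                      (cong (f v e *ℤ_) (∑-affine (e + z + β) α≢0 (f v′)))) ⟩
    ∑[ e ] (f v e *ℤ fiberMass v′)
      ≡⟨ sym (*-distribʳ-∑ (fiberMass v′) elements (f v)) ⟩
    fiberMass v *ℤ fiberMass v′ ∎
    where
    open ≡-Reasoning
    α = (v - v′) + (v - v′)
    β = v′ ² - v ²
    α≢0 : α ≢ 0#
    α≢0 α≡0 = v≢v′ (x-y≡0⇒x≡y (x+x≡0⇒x≡0 2≢0 α≡0))
    -- the two parabola conditions differ by an affine function of the vertex abscissa w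
    vertex-difference : ∀ d w → d + z + (w - v′) ² ≡ α * w + (d + (w - v) ² + z + β)
    vertex-difference d w = solve 5
      (λ d z w v v′ → d :+ z :+ (w :- v′) :* (w :- v′)
                   := ((v :- v′) :+ (v :- v′)) :* w :+ (d :+ (w :- v) :* (w :- v) :+ z :+ (v′ :* v′ :- v :* v)))
      refl d z w v v′
    shift-vertex : ∀ w → ∑[ d ] (f v (d + (w - v) ²) *ℤ f v′ (d + z + (w - v′) ²))
                       ≡ ∑[ e ] (f v e *ℤ f v′ (α * w + (e + z + β)))
    shift-vertex w = trans
      (∑-cong elements λ d → cong (λ y → f v (d + (w - v) ²) *ℤ f v′ y) (vertex-difference d w))
      (∑-shift ((w - v) ²) (λ e → f v e *ℤ f v′ (α * w + (e + z + β))))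

  ∑-autocorrelation-parabolaMass : 1# + 1# ≢ 0# → ∀ z →
    ∑[ w ] autocorrelation (parabolaMass w) z ≡ q *ℤ fiberCorrelation z -ℤ fiberSquares +ℤ mass *ℤ mass
  ∑-autocorrelation-parabolaMass 2≢0 z = begin
    ∑[ w ] ∑[ d ] (parabolaMass w d *ℤ parabolaMass w (d + z))
      ≡⟨ ∑-cong elements (λ w → ∑-cong elements λ d → ∑*∑ elements elements _ _) ⟩
    ∑[ w ] ∑[ d ] ∑[ v ] ∑[ v′ ] (f v (d + (w - v) ²) *ℤ f v′ (d + z + (w - v′) ²))
      ≡⟨ ∑-cong elements (λ w → ∑-rotate elements elements elements _) ⟩
    ∑[ w ] ∑[ v ] ∑[ v′ ] ∑[ d ] (f v (d + (w - v) ²) *ℤ f v′ (d + z + (w - v′) ²))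
      ≡⟨ ∑-rotate elements elements elements _ ⟩
    ∑[ v ] ∑[ v′ ] parabolaOverlap v v′ z
      ≡⟨ ∑∑-offDiagonal (λ v v′ → parabolaOverlap v v′ z) fiberMass (parabolaOverlap-offDiagonal 2≢0 z) ⟩
    ∑[ v ] (parabolaOverlap v v z -ℤ fiberMass v *ℤ fiberMass v) +ℤ mass *ℤ mass
      ≡⟨ cong (_+ℤ mass *ℤ mass) (∑-distrib-- elements _ _) ⟩
    ∑[ v ] parabolaOverlap v v z -ℤ fiberSquares +ℤ mass *ℤ mass
      ≡⟨ cong (λ s → s -ℤ fiberSquares +ℤ mass *ℤ mass)
              (trans (∑-cong elements λ v → parabolaOverlap-diagonal v z) (sym (*-distribˡ-∑ q elements _))) ⟩
    q *ℤ fiberCorrelation z -ℤ fiberSquares +ℤ mass *ℤ mass ∎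
    where open ≡-Reasoning

  centeredParabolaMass : Carrier → Carrier → ℤ
  centeredParabolaMass w d = q *ℤ parabolaMass w d -ℤ mass

  centeredDistanceMass : Carrier → ℤ
  centeredDistanceMass t = ∑[ u ] correlation (f u) (centeredParabolaMass u) t

  centeredParabolaCorrelation : Carrier → ℤ
  centeredParabolaCorrelation z = ∑[ w ] autocorrelation (centeredParabolaMass w) z

  distanceEnergy : ℤ
  distanceEnergy = ∑[ t ] (distanceMass t *ℤ distanceMass t)

  fiberCorrelationEnergy : ℤ
  fiberCorrelationEnergy = ∑[ z ] (fiberCorrelation z *ℤ fiberCorrelation z)

  centeredDistanceMass≡ : ∀ t → centeredDistanceMass t ≡ q *ℤ distanceMass t -ℤ mass *ℤ mass
  centeredDistanceMass≡ t = begin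
    ∑[ u ] correlation (f u) (centeredParabolaMass u) t
      ≡⟨ ∑-cong elements (λ u → correlation-affineʳ (f u) (parabolaMass u) q mass t) ⟩
    ∑[ u ] (q *ℤ correlation (f u) (parabolaMass u) t -ℤ mass *ℤ fiberMass u)
      ≡⟨ ∑-distrib-- elements _ _ ⟩
    ∑[ u ] (q *ℤ correlation (f u) (parabolaMass u) t) -ℤ ∑[ u ] (mass *ℤ fiberMass u)
      ≡⟨ sym (cong₂ _-ℤ_ (*-distribˡ-∑ q elements _) (*-distribˡ-∑ mass elements fiberMass)) ⟩
    q *ℤ distanceMass t -ℤ mass *ℤ mass ∎
    where open ≡-Reasoning

  ∑-centeredDistanceMass² : ∑[ t ] (centeredDistanceMass t *ℤ centeredDistanceMass t)
                          ≡ q *ℤ q *ℤ distanceEnergy -ℤ q *ℤ (N *ℤ N)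
  ∑-centeredDistanceMass² = begin
    ∑[ t ] (centeredDistanceMass t *ℤ centeredDistanceMass t)
      ≡⟨ ∑-cong elements (λ t → cong₂ _*ℤ_ (centeredDistanceMass≡ t) (centeredDistanceMass≡ t)) ⟩
    ∑[ t ] ((q *ℤ distanceMass t -ℤ N) *ℤ (q *ℤ distanceMass t -ℤ N))
      ≡⟨ ∑-cong elements (λ t → expand q N (distanceMass t)) ⟩
    ∑[ t ] (q *ℤ q *ℤ (distanceMass t *ℤ distanceMass t) +ℤ -ℤ (+ 2 *ℤ q *ℤ N) *ℤ distanceMass t +ℤ N *ℤ N)
      ≡⟨ ∑-linear (q *ℤ q) (-ℤ (+ 2 *ℤ q *ℤ N)) (N *ℤ N) _ distanceMass ⟩
    q *ℤ q *ℤ distanceEnergy +ℤ -ℤ (+ 2 *ℤ q *ℤ N) *ℤ ∑ᶠ distanceMass +ℤ q *ℤ (N *ℤ N)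
      ≡⟨ cong (λ s → q *ℤ q *ℤ distanceEnergy +ℤ -ℤ (+ 2 *ℤ q *ℤ N) *ℤ s +ℤ q *ℤ (N *ℤ N)) ∑-distanceMass ⟩
    q *ℤ q *ℤ distanceEnergy +ℤ -ℤ (+ 2 *ℤ q *ℤ N) *ℤ N +ℤ q *ℤ (N *ℤ N)
      ≡⟨ collect q distanceEnergy N ⟩
    q *ℤ q *ℤ distanceEnergy -ℤ q *ℤ (N *ℤ N) ∎
    where
    open ≡-Reasoning
    expand : ∀ q n x → (q *ℤ x -ℤ n) *ℤ (q *ℤ x -ℤ n)
                     ≡ q *ℤ q *ℤ (x *ℤ x) +ℤ -ℤ (+ 2 *ℤ q *ℤ n) *ℤ x +ℤ n *ℤ n
    expand = solve-∀
    collect : ∀ q v n → q *ℤ q *ℤ v +ℤ -ℤ (+ 2 *ℤ q *ℤ n) *ℤ n +ℤ q *ℤ (n *ℤ n)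
                      ≡ q *ℤ q *ℤ v -ℤ q *ℤ (n *ℤ n)
    collect = solve-∀

  autocorrelation-centeredParabolaMass : ∀ w z →
    autocorrelation (centeredParabolaMass w) z ≡ q *ℤ q *ℤ autocorrelation (parabolaMass w) z -ℤ q *ℤ N
  autocorrelation-centeredParabolaMass w z = begin
    autocorrelation (centeredParabolaMass w) z
      ≡⟨ autocorrelation-affine (parabolaMass w) q mass z ⟩
    q *ℤ q *ℤ A -ℤ + 2 *ℤ q *ℤ mass *ℤ ∑ᶠ (parabolaMass w) +ℤ q *ℤ mass *ℤ mass
      ≡⟨ cong (λ s → q *ℤ q *ℤ A -ℤ + 2 *ℤ q *ℤ mass *ℤ s +ℤ q *ℤ mass *ℤ mass) (∑-parabolaMass w) ⟩
    q *ℤ q *ℤ A -ℤ + 2 *ℤ q *ℤ mass *ℤ mass +ℤ q *ℤ mass *ℤ mass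
      ≡⟨ collapse q A mass ⟩
    q *ℤ q *ℤ A -ℤ q *ℤ N ∎
    where
    open ≡-Reasoning
    A = autocorrelation (parabolaMass w) z
    collapse : ∀ q a n → q *ℤ q *ℤ a -ℤ + 2 *ℤ q *ℤ n *ℤ n +ℤ q *ℤ n *ℤ n ≡ q *ℤ q *ℤ a -ℤ q *ℤ (n *ℤ n)
    collapse = solve-∀

  centeredParabolaCorrelation≡ : 1# + 1# ≢ 0# → ∀ z →
    centeredParabolaCorrelation z ≡ q *ℤ q *ℤ q *ℤ fiberCorrelation z -ℤ q *ℤ q *ℤ fiberSquares
  centeredParabolaCorrelation≡ 2≢0 z = begin
    ∑[ w ] autocorrelation (centeredParabolaMass w) z
      ≡⟨ ∑-cong elements (λ w → autocorrelation-centeredParabolaMass w z) ⟩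
    ∑[ w ] (q *ℤ q *ℤ A w -ℤ q *ℤ N)
      ≡⟨ ∑-distrib-- elements _ _ ⟩
    ∑[ w ] (q *ℤ q *ℤ A w) -ℤ ∑[ w ] (q *ℤ N)
      ≡⟨ cong₂ _-ℤ_ (sym (*-distribˡ-∑ (q *ℤ q) elements A)) (∑-const elements (q *ℤ N)) ⟩
    q *ℤ q *ℤ ∑ᶠ A -ℤ q *ℤ (q *ℤ N)
      ≡⟨ cong (λ K → q *ℤ q *ℤ K -ℤ q *ℤ (q *ℤ N)) (∑-autocorrelation-parabolaMass 2≢0 z) ⟩
    q *ℤ q *ℤ (q *ℤ fiberCorrelation z -ℤ fiberSquares +ℤ N) -ℤ q *ℤ (q *ℤ N)
      ≡⟨ collect q (fiberCorrelation z) fiberSquares N ⟩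
    q *ℤ q *ℤ q *ℤ fiberCorrelation z -ℤ q *ℤ q *ℤ fiberSquares ∎
    where
    open ≡-Reasoning
    A : Carrier → ℤ
    A w = autocorrelation (parabolaMass w) z
    collect : ∀ q h s n → q *ℤ q *ℤ (q *ℤ h -ℤ s +ℤ n) -ℤ q *ℤ (q *ℤ n) ≡ q *ℤ q *ℤ q *ℤ h -ℤ q *ℤ q *ℤ s
    collect = solve-∀

  ∑-fiberCorrelation*centeredParabolaCorrelation : 1# + 1# ≢ 0# →
    ∑[ z ] (fiberCorrelation z *ℤ centeredParabolaCorrelation z)
      ≡ q *ℤ q *ℤ q *ℤ fiberCorrelationEnergy -ℤ (q *ℤ fiberSquares) *ℤ (q *ℤ fiberSquares)
  ∑-fiberCorrelation*centeredParabolaCorrelation 2≢0 = begin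
    ∑[ z ] (fiberCorrelation z *ℤ centeredParabolaCorrelation z)
      ≡⟨ ∑-cong elements (λ z → cong (fiberCorrelation z *ℤ_) (centeredParabolaCorrelation≡ 2≢0 z)) ⟩
    ∑[ z ] (fiberCorrelation z *ℤ (q *ℤ q *ℤ q *ℤ fiberCorrelation z -ℤ q *ℤ q *ℤ S))
      ≡⟨ ∑-cong elements (λ z → expand q S (fiberCorrelation z)) ⟩
    ∑[ z ] (q *ℤ q *ℤ q *ℤ (fiberCorrelation z *ℤ fiberCorrelation z) +ℤ -ℤ (q *ℤ q *ℤ S) *ℤ fiberCorrelation z +ℤ 0ℤ)
      ≡⟨ ∑-linear (q *ℤ q *ℤ q) (-ℤ (q *ℤ q *ℤ S)) 0ℤ _ fiberCorrelation ⟩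
    q *ℤ q *ℤ q *ℤ fiberCorrelationEnergy +ℤ -ℤ (q *ℤ q *ℤ S) *ℤ ∑ᶠ fiberCorrelation +ℤ q *ℤ 0ℤ
      ≡⟨ cong (λ s → q *ℤ q *ℤ q *ℤ fiberCorrelationEnergy +ℤ -ℤ (q *ℤ q *ℤ S) *ℤ s +ℤ q *ℤ 0ℤ) ∑-fiberCorrelation ⟩
    q *ℤ q *ℤ q *ℤ fiberCorrelationEnergy +ℤ -ℤ (q *ℤ q *ℤ S) *ℤ S +ℤ q *ℤ 0ℤ
      ≡⟨ collect q fiberCorrelationEnergy S ⟩
    q *ℤ q *ℤ q *ℤ fiberCorrelationEnergy -ℤ (q *ℤ S) *ℤ (q *ℤ S) ∎
    where
    open ≡-Reasoning
    S = fiberSquares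
    expand : ∀ q s h → h *ℤ (q *ℤ q *ℤ q *ℤ h -ℤ q *ℤ q *ℤ s)
                     ≡ q *ℤ q *ℤ q *ℤ (h *ℤ h) +ℤ -ℤ (q *ℤ q *ℤ s) *ℤ h +ℤ 0ℤ
    expand = solve-∀
    collect : ∀ q e s → q *ℤ q *ℤ q *ℤ e +ℤ -ℤ (q *ℤ q *ℤ s) *ℤ s +ℤ q *ℤ 0ℤ
                      ≡ q *ℤ q *ℤ q *ℤ e -ℤ (q *ℤ s) *ℤ (q *ℤ s)
    collect = solve-∀

  parabolicEnergy-≤ : 1# + 1# ≢ 0# → q *ℤ distanceEnergy ≤ℤ mass ^ 4 +ℤ q ^ 2 *ℤ fiberCorrelationEnergy
  parabolicEnergy-≤ 2≢0 = q-cancelˡ-≤ (begin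
    q *ℤ (q *ℤ distanceEnergy)
      ≡⟨ expose q distanceEnergy (N *ℤ N) ⟩
    q *ℤ q *ℤ distanceEnergy -ℤ q *ℤ (N *ℤ N) +ℤ q *ℤ (N *ℤ N)
      ≡⟨ cong (_+ℤ q *ℤ (N *ℤ N)) (sym ∑-centeredDistanceMass²) ⟩
    ∑[ t ] (centeredDistanceMass t *ℤ centeredDistanceMass t) +ℤ q *ℤ (N *ℤ N)
      ≤⟨ ℤ.+-monoˡ-≤ (q *ℤ (N *ℤ N)) (correlation-energy-≤ f centeredParabolaMass) ⟩
    ∑[ z ] (fiberCorrelation z *ℤ centeredParabolaCorrelation z) +ℤ q *ℤ (N *ℤ N)
      ≡⟨ cong (_+ℤ q *ℤ (N *ℤ N)) (∑-fiberCorrelation*centeredParabolaCorrelation 2≢0) ⟩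
    q *ℤ q *ℤ q *ℤ fiberCorrelationEnergy -ℤ qS *ℤ qS +ℤ q *ℤ (N *ℤ N)
      ≤⟨ ℤ.+-monoˡ-≤ (q *ℤ (N *ℤ N)) (ℤ.i-j≤i (q *ℤ q *ℤ q *ℤ fiberCorrelationEnergy) (qS *ℤ qS)
                                                {{ℤ.nonNegative (0≤i*i qS)}}) ⟩
    q *ℤ q *ℤ q *ℤ fiberCorrelationEnergy +ℤ q *ℤ (N *ℤ N)
      ≡⟨ factor q fiberCorrelationEnergy mass ⟩
    q *ℤ (mass ^ 4 +ℤ q ^ 2 *ℤ fiberCorrelationEnergy) ∎)
    where
    open ℤ.≤-Reasoning
    qS = q *ℤ fiberSquares
    expose : ∀ q v m → q *ℤ (q *ℤ v) ≡ q *ℤ q *ℤ v -ℤ q *ℤ m +ℤ q *ℤ m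
    expose = solve-∀
    -- ℤ's _^_ is not recognised by the solver, so the powers are written out
    factor : ∀ q e m → q *ℤ q *ℤ q *ℤ e +ℤ q *ℤ (m *ℤ m *ℤ (m *ℤ m))
                     ≡ q *ℤ (m *ℤ (m *ℤ (m *ℤ (m *ℤ 1ℤ))) +ℤ q *ℤ (q *ℤ 1ℤ) *ℤ e)
    factor = solve-∀

module AdditiveEnergy (F : FiniteField) where

  open import Data.Bool using (_∧_)
  open import Data.Integer using (+_)
    renaming (_*_ to _*ℤ_)
  open import Data.Integer.Tactic.RingSolver using (solve-∀)
  open import Data.Product using (_×_; _,_)
  open import Function using (_∘_)
  open import Relation.Nullary.Decidable using (⌊_⌋)
  open import Relation.Binary.PropositionalEquality using (_≡_; refl; sym; trans; cong; module ≡-Reasoning)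
  open ≡-Reasoning

  open FiniteField F
  open FieldArithmetic F
  open FiniteFieldSums F
  open Correlations F

  ∑-quadruples : ∀ (g : (Carrier × Carrier) × (Carrier × Carrier) → ℤ) →
    ∑ ((elements ⊗ elements) ⊗ (elements ⊗ elements)) g ≡ ∑[ x ] ∑[ x′ ] ∑[ y ] ∑[ y′ ] g ((x , x′) , (y , y′))
  ∑-quadruples g = trans (∑-⊗ (elements ⊗ elements) (elements ⊗ elements) g)
    (trans (∑-⊗ elements elements _) (∑-cong elements λ x → ∑-cong elements λ x′ → ∑-⊗ elements elements _))

  additiveEnergy≡∑∑∑ : ∀ P Q → + additiveEnergy F P Q
    ≡ ∑[ x ] ∑[ x′ ] ∑[ y ] ((⟦ P x ⟧ *ℤ ⟦ P x′ ⟧) *ℤ (⟦ Q y ⟧ *ℤ ⟦ Q (x + y - x′) ⟧))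
  additiveEnergy≡∑∑∑ P Q = begin
    + additiveEnergy F P Q
      ≡⟨ count≡∑ _ ((elements ⊗ elements) ⊗ (elements ⊗ elements)) ⟩
    _ ≡⟨ ∑-quadruples _ ⟩
    ∑[ x ] ∑[ x′ ] ∑[ y ] ∑[ y′ ] ⟦ P x ∧ P x′ ∧ Q y ∧ Q y′ ∧ ⌊ (x + y) ≟ (x′ + y′) ⌋ ⟧
      ≡⟨ ∑-cong elements (λ x → ∑-cong elements λ x′ → ∑-cong elements λ y → trans
           (∑-cong elements (λ y′ → factorise x x′ y y′))
           (∑-δ (x + y - x′) (λ y′ → (⟦ P x ⟧ *ℤ ⟦ P x′ ⟧) *ℤ (⟦ Q y ⟧ *ℤ ⟦ Q y′ ⟧)))) ⟩
    ∑[ x ] ∑[ x′ ] ∑[ y ] ((⟦ P x ⟧ *ℤ ⟦ P x′ ⟧) *ℤ (⟦ Q y ⟧ *ℤ ⟦ Q (x + y - x′) ⟧)) ∎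
    where
    factorise : ∀ x x′ y y′ → ⟦ P x ∧ P x′ ∧ Q y ∧ Q y′ ∧ ⌊ (x + y) ≟ (x′ + y′) ⌋ ⟧
                            ≡ δ y′ (x + y - x′) *ℤ ((⟦ P x ⟧ *ℤ ⟦ P x′ ⟧) *ℤ (⟦ Q y ⟧ *ℤ ⟦ Q y′ ⟧))
    factorise x x′ y y′ = begin
      ⟦ P x ∧ P x′ ∧ Q y ∧ Q y′ ∧ ⌊ (x + y) ≟ (x′ + y′) ⌋ ⟧
        ≡⟨ ⟦∧⟧⁵ (P x) (P x′) (Q y) (Q y′) _ ⟩
      ⟦ P x ⟧ *ℤ (⟦ P x′ ⟧ *ℤ (⟦ Q y ⟧ *ℤ (⟦ Q y′ ⟧ *ℤ δ (x + y) (x′ + y′))))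
        ≡⟨ cong (λ d → ⟦ P x ⟧ *ℤ (⟦ P x′ ⟧ *ℤ (⟦ Q y ⟧ *ℤ (⟦ Q y′ ⟧ *ℤ d))))
                (δ-cong solve-for-y′ from-y′) ⟩
      ⟦ P x ⟧ *ℤ (⟦ P x′ ⟧ *ℤ (⟦ Q y ⟧ *ℤ (⟦ Q y′ ⟧ *ℤ δ y′ (x + y - x′))))
        ≡⟨ reorder ⟦ P x ⟧ ⟦ P x′ ⟧ ⟦ Q y ⟧ ⟦ Q y′ ⟧ (δ y′ (x + y - x′)) ⟩
      δ y′ (x + y - x′) *ℤ ((⟦ P x ⟧ *ℤ ⟦ P x′ ⟧) *ℤ (⟦ Q y ⟧ *ℤ ⟦ Q y′ ⟧)) ∎
      where
      ⟦∧⟧⁵ : ∀ a b c d e →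
             ⟦ a ∧ b ∧ c ∧ d ∧ e ⟧ ≡ ⟦ a ⟧ *ℤ (⟦ b ⟧ *ℤ (⟦ c ⟧ *ℤ (⟦ d ⟧ *ℤ ⟦ e ⟧)))
      ⟦∧⟧⁵ a b c d e = trans (⟦∧⟧ a _) (cong (⟦ a ⟧ *ℤ_) (trans (⟦∧⟧ b _) (cong (⟦ b ⟧ *ℤ_)
                         (trans (⟦∧⟧ c _) (cong (⟦ c ⟧ *ℤ_) (⟦∧⟧ d e))))))
      solve-for-y′ : x + y ≡ x′ + y′ → y′ ≡ x + y - x′
      solve-for-y′ e = trans (solve 2 (λ x′ y′ → y′ := x′ :+ y′ :- x′) refl x′ y′) (cong (_- x′) (sym e))
      from-y′ : y′ ≡ x + y - x′ → x + y ≡ x′ + y′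
      from-y′ e = trans (solve 3 (λ x y x′ → x :+ y := x′ :+ (x :+ y :- x′)) refl x y x′) (cong (_+_ x′) (sym e))
      reorder : ∀ a b c d e → a *ℤ (b *ℤ (c *ℤ (d *ℤ e))) ≡ e *ℤ ((a *ℤ b) *ℤ (c *ℤ d))
      reorder = solve-∀

  additiveEnergy≡∑autocorrelation² : ∀ P Q →
    + additiveEnergy F P Q ≡ ∑[ z ] (autocorrelation (⟦_⟧ ∘ P) z *ℤ autocorrelation (⟦_⟧ ∘ Q) z)
  additiveEnergy≡∑autocorrelation² P Q =
    trans (additiveEnergy≡∑∑∑ P Q) (sym (∑-autocorrelation*autocorrelation (⟦_⟧ ∘ P) (⟦_⟧ ∘ Q)))

module DistanceCounts (F : FiniteField) (E : Pt F → Bool) where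

  open FiniteField F

  open import Data.Bool using (_∧_)
  open import Data.Bool.ListAction using (any)
  open import Data.Integer using (+_; 1ℤ; _^_)
    renaming (_+_ to _+ℤ_; _*_ to _*ℤ_; _≤_ to _≤ℤ_)
  import Data.Integer.Properties as ℤ
  open import Data.Integer.Tactic.RingSolver using (solve-∀)
  import Data.Nat as ℕ
  open import Data.Product using (_,_)
  open import Function using (_∘_)
  open import Relation.Nullary.Decidable using (⌊_⌋)
  open import Relation.Binary.PropositionalEquality using (_≡_; _≢_; refl; sym; trans; cong; cong₂; subst₂; module ≡-Reasoning)

  open FieldArithmetic F
  open FiniteFieldSums F
  open Correlations F
  open AdditiveEnergy F

  indicator : Carrier → Carrier → ℤ
  indicator u y = ⟦ E (u , y) ⟧

  open ParabolicEnergy F indicator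

  card≡mass : + card F E ≡ mass
  card≡mass = trans (count≡∑ E (points F)) (∑-⊗ elements elements (⟦_⟧ ∘ E))

  ν≡distanceMass : ∀ t → + ν F E t ≡ distanceMass t
  ν≡distanceMass t = begin
    + ν F E t
      ≡⟨ count≡∑ _ (points F ⊗ points F) ⟩
    _ ≡⟨ ∑-quadruples _ ⟩
    ∑[ x₁ ] ∑[ x₂ ] ∑[ y₁ ] ∑[ y₂ ] ⟦ E (x₁ , x₂) ∧ E (y₁ , y₂) ∧ ⌊ ((x₂ - y₂) + (x₁ - y₁) ²) ≟ t ⌋ ⟧
      ≡⟨ ∑-cong elements (λ x₁ → ∑-cong elements λ x₂ → ∑-cong elements λ y₁ → trans
           (∑-cong elements (factorise x₁ x₂ y₁))
           (∑-δ (x₂ - t + (x₁ - y₁) ²) (λ y₂ → indicator x₁ x₂ *ℤ indicator y₁ y₂))) ⟩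
    ∑[ x₁ ] ∑[ x₂ ] ∑[ y₁ ] (indicator x₁ x₂ *ℤ indicator y₁ (x₂ - t + (x₁ - y₁) ²))
      ≡⟨ ∑-cong elements (λ x₁ → ∑-cong elements λ x₂ → sym (*-distribˡ-∑ (indicator x₁ x₂) elements _)) ⟩
    distanceMass t ∎
    where
    open ≡-Reasoning
    factorise : ∀ x₁ x₂ y₁ y₂ → ⟦ E (x₁ , x₂) ∧ E (y₁ , y₂) ∧ ⌊ ((x₂ - y₂) + (x₁ - y₁) ²) ≟ t ⌋ ⟧
                              ≡ δ y₂ (x₂ - t + (x₁ - y₁) ²) *ℤ (indicator x₁ x₂ *ℤ indicator y₁ y₂)
    factorise x₁ x₂ y₁ y₂ = begin
      ⟦ E (x₁ , x₂) ∧ E (y₁ , y₂) ∧ ⌊ ((x₂ - y₂) + s) ≟ t ⌋ ⟧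
        ≡⟨ trans (⟦∧⟧ (E (x₁ , x₂)) _) (cong (indicator x₁ x₂ *ℤ_) (⟦∧⟧ (E (y₁ , y₂)) _)) ⟩
      indicator x₁ x₂ *ℤ (indicator y₁ y₂ *ℤ δ ((x₂ - y₂) + s) t)
        ≡⟨ cong (λ d → indicator x₁ x₂ *ℤ (indicator y₁ y₂ *ℤ d)) (δ-cong solve-for-y₂ from-y₂) ⟩
      indicator x₁ x₂ *ℤ (indicator y₁ y₂ *ℤ δ y₂ (x₂ - t + s))
        ≡⟨ rotate (indicator x₁ x₂) (indicator y₁ y₂) (δ y₂ (x₂ - t + s)) ⟩
      δ y₂ (x₂ - t + s) *ℤ (indicator x₁ x₂ *ℤ indicator y₁ y₂) ∎
      where
      s = (x₁ - y₁) ²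
      solve-for-y₂ : (x₂ - y₂) + s ≡ t → y₂ ≡ x₂ - t + s
      solve-for-y₂ e = trans (solve 3 (λ x₂ y₂ s → y₂ := x₂ :- ((x₂ :- y₂) :+ s) :+ s) refl x₂ y₂ s)
                             (cong (λ r → x₂ - r + s) e)
      from-y₂ : y₂ ≡ x₂ - t + s → (x₂ - y₂) + s ≡ t
      from-y₂ e = trans (cong (λ r → (x₂ - r) + s) e) (solve 3 (λ x₂ t s → (x₂ :- (x₂ :- t :+ s)) :+ s := t) refl x₂ t s)
      rotate : ∀ a b c → a *ℤ (b *ℤ c) ≡ c *ℤ (a *ℤ b)
      rotate = solve-∀

  sumν²≡distanceEnergy : + sumν² F E ≡ distanceEnergy
  sumν²≡distanceEnergy = trans (sum≡∑ _ elements)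
    (∑-cong elements λ t → trans (ℤ.pos-* (ν F E t) (ν F E t)) (cong₂ _*ℤ_ (ν≡distanceMass t) (ν≡distanceMass t)))

  fiberEnergy≡fiberCorrelationEnergy : + fiberEnergy F E ≡ fiberCorrelationEnergy
  fiberEnergy≡fiberCorrelationEnergy = begin
    + fiberEnergy F E
      ≡⟨ trans (sum≡∑ _ (elements ⊗ elements)) (∑-⊗ elements elements _) ⟩
    ∑[ u ] ∑[ u′ ] (+ additiveEnergy F (fiber F E u) (fiber F E u′))
      ≡⟨ ∑-cong elements (λ u → ∑-cong elements λ u′ → additiveEnergy≡∑autocorrelation² (fiber F E u) (fiber F E u′)) ⟩
    ∑[ u ] ∑[ u′ ] ∑[ z ] (autocorrelation (indicator u) z *ℤ autocorrelation (indicator u′) z)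
      ≡⟨ sym (∑-rotate elements elements elements _) ⟩
    ∑[ z ] ∑[ u ] ∑[ u′ ] (autocorrelation (indicator u) z *ℤ autocorrelation (indicator u′) z)
      ≡⟨ sym (∑-cong elements λ z → ∑*∑ elements elements _ _) ⟩
    ∑[ z ] (fiberCorrelation z *ℤ fiberCorrelation z) ∎
    where open ≡-Reasoning

  private
    -- the right-hand side is m ^ 4, unfolded for the solver
    square² : ∀ m → m *ℤ m *ℤ (m *ℤ m) ≡ m *ℤ (m *ℤ (m *ℤ (m *ℤ 1ℤ)))
    square² = solve-∀

    card⁴≡mass⁴ : + (card F E ℕ.^ 4) ≡ mass ^ 4
    card⁴≡mass⁴ = trans (pos-^ (card F E) 4) (cong (_^ 4) card≡mass)

  card⁴≤distanceSetSize*sumν² : card F E ℕ.^ 4 ℕ.≤ distanceSetSize F E ℕ.* sumν² F E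
  card⁴≤distanceSetSize*sumν² = ℤ.drop‿+≤+ (subst₂ _≤ℤ_ lhs rhs (cauchy-schwarz elements realised ν′))
    where
    realised ν′ : Carrier → ℤ
    realised t = ⟦ any (distIs F E t) (points F ⊗ points F) ⟧
    ν′ t = + ν F E t
    ∑realised*ν′ : ∑[ t ] (realised t *ℤ ν′ t) ≡ mass *ℤ mass
    ∑realised*ν′ = trans
      (∑-cong elements λ t → trans (⟦any⟧*count (distIs F E t) (points F ⊗ points F)) (ν≡distanceMass t))
      ∑-distanceMass
    lhs : ∑[ t ] (realised t *ℤ ν′ t) *ℤ ∑[ t ] (realised t *ℤ ν′ t) ≡ + (card F E ℕ.^ 4)
    lhs = trans (cong₂ _*ℤ_ ∑realised*ν′ ∑realised*ν′) (trans (square² mass) (sym card⁴≡mass⁴))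
    rhs : ∑[ t ] (realised t *ℤ realised t) *ℤ ∑[ t ] (ν′ t *ℤ ν′ t) ≡ + (distanceSetSize F E ℕ.* sumν² F E)
    rhs = sym (trans (ℤ.pos-* (distanceSetSize F E) (sumν² F E)) (cong₂ _*ℤ_
      (trans (count≡∑ _ elements) (sym (∑-cong elements λ t → ⟦b⟧*⟦b⟧ (any (distIs F E t) (points F ⊗ points F)))))
      (trans (sum≡∑ _ elements) (∑-cong elements λ t → ℤ.pos-* (ν F E t) (ν F E t)))))

  order*sumν²≤card⁴+order²*fiberEnergy : 1# + 1# ≢ 0# →
    order ℕ.* sumν² F E ℕ.≤ card F E ℕ.^ 4 ℕ.+ order ℕ.^ 2 ℕ.* fiberEnergy F E
  order*sumν²≤card⁴+order²*fiberEnergy 2≢0 = ℤ.drop‿+≤+ (subst₂ _≤ℤ_ lhs rhs (parabolicEnergy-≤ 2≢0))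
    where
    lhs : q *ℤ distanceEnergy ≡ + (order ℕ.* sumν² F E)
    lhs = sym (trans (ℤ.pos-* order (sumν² F E)) (cong (q *ℤ_) sumν²≡distanceEnergy))
    rhs : mass ^ 4 +ℤ q ^ 2 *ℤ fiberCorrelationEnergy ≡ + (card F E ℕ.^ 4 ℕ.+ order ℕ.^ 2 ℕ.* fiberEnergy F E)
    rhs = sym (trans (ℤ.pos-+ (card F E ℕ.^ 4) (order ℕ.^ 2 ℕ.* fiberEnergy F E)) (cong₂ _+ℤ_ card⁴≡mass⁴
                (trans (ℤ.pos-* (order ℕ.^ 2) (fiberEnergy F E))
                       (cong₂ _*ℤ_ (pos-^ order 2) fiberEnergy≡fiberCorrelationEnergy))))

module Characteristic (F : FiniteField) where

  open import Data.Bool using (Bool)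
  open import Data.Fin using (toℕ)
  import Data.Fin.Properties as Fin
  open import Data.Integer using (+_; 1ℤ) renaming (_+_ to _+ℤ_; _*_ to _*ℤ_)
  import Data.Integer.Properties as ℤ
  open import Data.List using (lookup)
  open import Data.List.Relation.Unary.Any using (index)
  open import Data.List.Relation.Unary.Any.Properties using (lookup-index)
  open import Data.Nat as ℕ using (ℕ; _<?_)
  import Data.Nat.Properties as ℕ
  open import Data.Nat.Divisibility using (_∣_; divides)
  open import Function using (_∘_)
  open import Relation.Nullary using (¬_; yes; no; contradiction)
  open import Relation.Nullary.Decidable using (⌊_⌋)
  open import Relation.Binary.PropositionalEquality using (_≡_; _≢_; refl; sym; trans; cong; cong₂; module ≡-Reasoning)

  open FiniteField F
  open FieldArithmetic F
  open FiniteFieldSums F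

  -- Exactly one member of each orbit {x , σ x} comes first in the enumeration.
  fixedPointFree-involution⇒even : ∀ (σ : Carrier → Carrier) →
    (∀ x → σ (σ x) ≡ x) → (∀ x → σ x ≢ x) → 2 ∣ order
  fixedPointFree-involution⇒even σ σσ≡id σx≢x = divides c (trans (ℤ.+-injective order≡c+c) (c+c≡c*2 c))
    where
    open ≡-Reasoning
    position : Carrier → ℕ
    position x = toℕ (index (complete x))

    position-injective : ∀ {x y} → position x ≡ position y → x ≡ y
    position-injective {x} {y} eq =
      trans (lookup-index (complete x)) (trans (cong (lookup elements) (Fin.toℕ-injective eq)) (sym (lookup-index (complete y))))

    first : Carrier → Bool
    first x = ⌊ position x <? position (σ x) ⌋

    c : ℕ
    c = count first elements

    exactly-one : ∀ m n → m ≢ n → 1ℤ ≡ ⟦ ⌊ m <? n ⌋ ⟧ +ℤ ⟦ ⌊ n <? m ⌋ ⟧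
    exactly-one m n m≢n with m <? n | n <? m
    ... | yes m<n | yes n<m = contradiction n<m (ℕ.<-asym m<n)
    ... | yes _   | no _    = refl
    ... | no _    | yes _   = refl
    ... | no m≮n  | no n≮m  = contradiction (ℕ.≤-antisym (ℕ.≮⇒≥ n≮m) (ℕ.≮⇒≥ m≮n)) m≢n

    orbit-split : ∀ x → 1ℤ ≡ ⟦ first x ⟧ +ℤ ⟦ first (σ x) ⟧
    orbit-split x = trans
      (exactly-one (position x) (position (σ x)) (λ eq → σx≢x x (sym (position-injective eq))))
      (cong (λ y → ⟦ first x ⟧ +ℤ ⟦ ⌊ position (σ x) <? position y ⌋ ⟧) (sym (σσ≡id x)))

    order≡c+c : + order ≡ + c +ℤ + c
    order≡c+c = begin
      + order
        ≡⟨ sym (trans (∑-const elements 1ℤ) (ℤ.*-identityʳ q)) ⟩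
      ∑[ x ] 1ℤ
        ≡⟨ ∑-cong elements orbit-split ⟩
      ∑[ x ] (⟦ first x ⟧ +ℤ ⟦ first (σ x) ⟧)
        ≡⟨ ∑-distrib-+ elements _ _ ⟩
      ∑[ x ] ⟦ first x ⟧ +ℤ ∑[ x ] ⟦ first (σ x) ⟧
        ≡⟨ cong (∑[ x ] ⟦ first x ⟧ +ℤ_) (∑-reindex σ σ σσ≡id σσ≡id (⟦_⟧ ∘ first)) ⟩
      ∑[ x ] ⟦ first x ⟧ +ℤ ∑[ x ] ⟦ first x ⟧
        ≡⟨ sym (cong₂ _+ℤ_ (count≡∑ first elements) (count≡∑ first elements)) ⟩
      + c +ℤ + c ∎

    c+c≡c*2 : ∀ n → n ℕ.+ n ≡ n ℕ.* 2
    c+c≡c*2 n = sym (trans (ℕ.*-suc n 1) (cong (n ℕ.+_) (ℕ.*-identityʳ n)))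

  odd-order⇒1+1≢0 : ¬ 2 ∣ order → 1# + 1# ≢ 0#
  odd-order⇒1+1≢0 odd 1+1≡0 = odd (fixedPointFree-involution⇒even (_+ 1#) +1+1≡id +1≢id)
    where
    +1+1≡id : ∀ x → x + 1# + 1# ≡ x
    +1+1≡id x = begin
      x + 1# + 1#    ≡⟨ solve 2 (λ x o → x :+ o :+ o := x :+ (o :+ o)) refl x 1# ⟩
      x + (1# + 1#)  ≡⟨ cong (_+_ x) 1+1≡0 ⟩
      x + 0#         ≡⟨ +-identityʳ x ⟩
      x              ∎
      where open ≡-Reasoning
    +1≢id : ∀ x → x + 1# ≢ x
    +1≢id x x+1≡x = 0≢1 (sym (begin
      1#            ≡⟨ solve 2 (λ x o → o := x :+ o :- x) refl x 1# ⟩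
      x + 1# - x    ≡⟨ cong (_- x) x+1≡x ⟩
      x - x         ≡⟨ -‿inverseʳ x ⟩
      0#            ∎))
      where open ≡-Reasoning

import Data.Nat.Properties
open import Algebra.Properties.CommutativeSemigroup Data.Nat.Properties.*-commutativeSemigroup using (x∙yz≈y∙xz)
open import Data.Bool using (true)
open import Data.Nat using (ℕ; suc; _+_; _*_; _^_; _≤_)
open import Data.Nat.Primality using (Prime)
open import Data.Nat.Divisibility using (_∣_)
open import Data.Nat.Properties using (*-monoʳ-≤; module ≤-Reasoning)
open import Data.Product using (_×_; _,_; ∃; ∃₂)
open import Relation.Nullary using (¬_)
open import Relation.Binary.PropositionalEquality using (_≡_)

theorem6p1 : (F : FiniteField) →
    (∃₂ λ p k → Prime p × FiniteField.order F ≡ p ^ suc k) →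
    ¬ (2 ∣ FiniteField.order F) →
    (E : Pt F → Bool) → (∃ λ x → E x ≡ true) →
    (FiniteField.order F * sumν² F E
        ≤ card F E ^ 4 + FiniteField.order F ^ 2 * fiberEnergy F E)
    × (FiniteField.order F * card F E ^ 4
        ≤ distanceSetSize F E * (card F E ^ 4 + FiniteField.order F ^ 2 * fiberEnergy F E))
theorem6p1 F _ odd E _ = energy , distance
  where
  open FiniteField F using (order)
  open DistanceCounts F E using (order*sumν²≤card⁴+order²*fiberEnergy; card⁴≤distanceSetSize*sumν²)
  open Characteristic F using (odd-order⇒1+1≢0)
  open ≤-Reasoning

  energy : order * sumν² F E ≤ card F E ^ 4 + order ^ 2 * fiberEnergy F E
  energy = order*sumν²≤card⁴+order²*fiberEnergy (odd-order⇒1+1≢0 odd)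

  distance : order * card F E ^ 4 ≤ distanceSetSize F E * (card F E ^ 4 + order ^ 2 * fiberEnergy F E)
  distance = begin
    order * card F E ^ 4                                 ≤⟨ *-monoʳ-≤ order card⁴≤distanceSetSize*sumν² ⟩
    order * (distanceSetSize F E * sumν² F E)            ≡⟨ x∙yz≈y∙xz order (distanceSetSize F E) (sumν² F E) ⟩
    distanceSetSize F E * (order * sumν² F E)            ≤⟨ *-monoʳ-≤ (distanceSetSize F E) energy ⟩
    distanceSetSize F E * (card F E ^ 4 + order ^ 2 * fiberEnergy F E) ∎
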